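{- Let $0\le t\le h-1$ with $t\equiv h+1\pmod 2$, $h\le n$. Then $D_{n,h}(0,t,n-t)=0$, i.e. $$\sum_{0\le s\le\min(h,t)}\ \sum_{s\le i\le\min(s+n-t,h)}M_{n,h}(0,t,n-t,i,s)+\frac{(-q)^{ -\frac{(h-t)(h+t+1)}{2}}}{1-(-q)^{ -(h-t)}}=0.$$
   Context: $q$ is a power of an odd prime. Put $P(k)=\prod_{l=1}^{k}(1-(-q)^{ -l})$ (empty products $=1$, empty sums $=0$). For nonnegative integers $a,b,c$ and integer $j$: if $a+b>0$, $\mathcal C_j(a,b,c)=(-1)^{j+1}\prod_{i=1}^{a+b-1}(1-(-q)^i)$; and $\mathcal C_j(0,0,c)=\sum_{l=1}^{c}\frac1{(-q)^l-1}$. Let $M_{n,h}(a,b,c,i,s)=(-q)^{n(h-i)+\frac{(i-s)(2n-i+s+1)}{2}-h^2+s(2n-2c-s)}(-1)^{i+h}\frac{P(n-i)}{P(n-h)P(h)}\cdot\frac{\prod_{l=s+1}^{h}(1-(-q)^{ -l})}{P(h-i)P(i-s)}\cdot\frac{P(c)P(b)}{P(c-i+s)P(b-s)}\cdot\mathcal C_{h+1-s}(a,b-s,c+s-i)$. $D_{n,h}(0,t,n-t)$ denotes the left-hand side of the displayed identity (it is the Cho–Yamauchi constant attached to fundamental invariants $(1^t,0^{n-t})$). -}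

module Defs where

open import Data.Nat as ℕ using (ℕ; zero; suc; _∸_; _⊔_; _⊓_)
open import Data.Integer as ℤ using (ℤ; +_; -[1+_])
open import Data.Rational as ℚ using (ℚ; 0ℚ; 1ℚ; _+_; _*_; _-_; -_; 1/_; ≢-nonZero)
open import Data.Rational.Properties using (_≟_)
open import Data.List using (List; foldr; applyUpTo)
open import Relation.Nullary using (yes; no)

-- total inverse (convention 0⁻¹ = 0; only ever applied to nonzero values here)
inv : ℚ → ℚ
inv p with p ≟ 0ℚ
... | yes _  = 0ℚ
... | no p≢0 = 1/_ p {{≢-nonZero p≢0}}

infixl 7 _÷'_
_÷'_ : ℚ → ℚ → ℚ
p ÷' r = p * inv r

powℕ : ℚ → ℕ → ℚ
powℕ x zero    = 1ℚ
powℕ x (suc k) = x * powℕ x k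

powℤ : ℚ → ℤ → ℚ
powℤ x (+ k)     = powℕ x k
powℤ x -[1+ k ]  = inv (powℕ x (suc k))

-- the list [a, a+1, ..., b]  (empty if b < a)
range : ℕ → ℕ → List ℕ
range a b = applyUpTo (ℕ._+_ a) (suc b ∸ a)

sumFT : ℕ → ℕ → (ℕ → ℚ) → ℚ
sumFT a b f = foldr (λ k acc → f k + acc) 0ℚ (range a b)

prodFT : ℕ → ℕ → (ℕ → ℚ) → ℚ
prodFT a b f = foldr (λ k acc → f k * acc) 1ℚ (range a b)

module _ (q : ℕ) where

  mq : ℚ
  mq = (ℤ.- (+ q)) ℚ./ 1

  mqz : ℤ → ℚ
  mqz e = powℤ mq e

  mqn : ℕ → ℚ
  mqn k = powℕ mq k

  P : ℕ → ℚ
  P k = prodFT 1 k (λ l → 1ℚ - mqz (ℤ.- (+ l)))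

  sgn : ℕ → ℚ
  sgn k = powℕ (- 1ℚ) k

  Cc : ℤ → ℕ → ℕ → ℕ → ℚ
  Cc j zero zero c = sumFT 1 c (λ l → 1ℚ ÷' (mqn l - 1ℚ))
  Cc j a b c =
    powℤ (- 1ℚ) (j ℤ.+ ℤ.1ℤ) * prodFT 1 (ℕ._+_ a b ∸ 1) (λ i → 1ℚ - mqn i)

  -- exponent n(h-i) + (i-s)(2n-i+s+1)/2 - h^2 + s(2n-2c-s), computed in ℤ;
  -- (i-s)(2n+1-(i-s)) is a product of two numbers of opposite parity, hence even,
  -- so the ℕ-division by 2 is exact (in the range i-s ≤ n where it is used).
  Mexp : ℕ → ℕ → ℕ → ℕ → ℕ → ℤ
  Mexp n h c i s =
    (+ n) ℤ.* ((+ h) ℤ.- (+ i))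
    ℤ.+ (+ (ℕ._/_ (ℕ._*_ (i ∸ s) (ℕ._+_ (ℕ._*_ 2 n) 1 ∸ (i ∸ s))) 2))
    ℤ.- (+ h) ℤ.* (+ h)
    ℤ.+ (+ s) ℤ.* ((+ 2) ℤ.* (+ n) ℤ.- (+ 2) ℤ.* (+ c) ℤ.- (+ s))

  M : ℕ → ℕ → ℕ → ℕ → ℕ → ℕ → ℕ → ℚ
  M n h a b c i s =
    mqz (Mexp n h c i s)
    * sgn (ℕ._+_ i h)
    * (P (n ∸ i) ÷' (P (n ∸ h) * P h))
    * (prodFT (suc s) h (λ l → 1ℚ - mqz (ℤ.- (+ l))) ÷' (P (h ∸ i) * P (i ∸ s)))
    * ((P c * P b) ÷' (P (ℕ._+_ c s ∸ i) * P (b ∸ s)))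
    * Cc ((+ suc h) ℤ.- (+ s)) a (b ∸ s) (ℕ._+_ c s ∸ i)

  D0 : ℕ → ℕ → ℕ → ℚ
  D0 n h t =
    sumFT 0 (h ⊓ t) (λ s →
      sumFT s ((ℕ._+_ s (n ∸ t)) ⊓ h) (λ i → M n h 0 t (n ∸ t) i s))
    + mqz (ℤ.- (+ (ℕ._/_ (ℕ._*_ (h ∸ t) (ℕ._+_ (ℕ._+_ h t) 1)) 2)))
      ÷' (1ℚ - mqz (ℤ.- (+ (h ∸ t))))

{-# OPTIONS --safe #-}

-- Write y = (-q)⁻¹ and P(k) = ∏_{l≤k} (1 - y^l).  Re-indexed by d = i - s, the s-th
-- inner sum of D is a factor independent of d times
--   Σ_{d ≤ min(H,A)} (-1)^d y^(d(d-1)/2) P(N-d) / (P(d) P(H-d) P(A-d)) · 𝒞_d,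
-- where N = n-s, H = h-s, A = n-t.  The signed y-binomial coefficients
-- (-1)^d y^(d(d-1)/2) P(U)/(P(d) P(U-d)) satisfy a Pascal rule which makes
-- Σ_{d≤U} coeff_d · g(d) = (Δ^U g)(0) for (Δ g)(d) = y^d (g(d) - g(d+1)).
-- For s < t, 𝒞_d does not depend on d, and with U = min(H,A) the remaining factor
-- P(N-d)/P(max(H,A)-d) is a Pochhammer symbol of length N - max(H,A) < U in y^(-d);
-- each Δ shortens it by one, so the inner sum vanishes.  For s = t, 𝒞_d is the
-- harmonic-type sum Σ_{l ≤ A-d} 1/((-q)^l - 1); one Δ turns it into y^A/(1 - y^(A-d)),
-- iterating Δ on reciprocal Pochhammer symbols gives a single closed-form term, and
-- this is exactly minus the last summand of D.
module Submission where

open import Data.Empty using (⊥-elim)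
open import Data.Integer as ℤ using (ℤ; +_; -[1+_])
import Data.Integer.Properties as ℤₚ
import Data.Integer.Tactic.RingSolver as ℤ-Solver
open import Data.List using (foldr; applyUpTo)
open import Data.Nat as ℕ using (ℕ; zero; suc; _∸_; _⊓_; s≤s)
import Data.Nat.Coprimality as Cop
import Data.Nat.DivMod as ℕ
import Data.Nat.Properties as ℕₚ
import Data.Nat.Tactic.RingSolver as ℕ-Solver
open import Data.Rational as ℚ using (ℚ; 0ℚ; 1ℚ; mkℚ; ≢-nonZero)
import Data.Rational.Properties as ℚₚ
open import Data.Sum using (inj₁; inj₂; [_,_]′)
open import Function using (_∘_)
open import Level using (0ℓ)
open import Relation.Binary.PropositionalEquality
open import Relation.Nullary.Decidable using (yes; no; Dec; dec⇒maybe)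
open import Tactic.RingSolver using (solve-∀)
open import Tactic.RingSolver.Core.AlmostCommutativeRing using (AlmostCommutativeRing; fromCommutativeRing)

open import Defs

-- ℚ arithmetic is opened only inside this module, so that _+_ in the statement of
-- proposition9p6 below is the one on ℕ.
module _ where
  open import Data.Rational using (_+_; _*_; _-_; -_)
  open ≡-Reasoning

  ℚ-ring : AlmostCommutativeRing 0ℓ 0ℓ
  ℚ-ring = fromCommutativeRing ℚₚ.+-*-commutativeRing (λ p → dec⇒maybe (0ℚ ℚₚ.≟ p))

  inv-inverseʳ : ∀ {p} → p ≢ 0ℚ → p * inv p ≡ 1ℚ
  inv-inverseʳ {p} p≢0 with p ℚₚ.≟ 0ℚ
  ... | yes p≡0 = ⊥-elim (p≢0 p≡0)
  ... | no  p≢0 = ℚₚ.*-inverseʳ p {{≢-nonZero p≢0}}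

  *-inv-cancelʳ : ∀ {p} → p ≢ 0ℚ → ∀ a → a * (p * inv p) ≡ a
  *-inv-cancelʳ p≢0 a = trans (cong (a *_) (inv-inverseʳ p≢0)) (ℚₚ.*-identityʳ a)

  *-≢0 : ∀ {a b} → a ≢ 0ℚ → b ≢ 0ℚ → a * b ≢ 0ℚ
  *-≢0 {a} {b} a≢0 b≢0 ab≡0 = 1≢0 (begin
    1ℚ                            ≡⟨ cong₂ _*_ (inv-inverseʳ a≢0) (inv-inverseʳ b≢0) ⟨
    (a * inv a) * (b * inv b)     ≡⟨ regroup a b (inv a) (inv b) ⟩
    (a * b) * (inv a * inv b)     ≡⟨ cong (_* (inv a * inv b)) ab≡0 ⟩
    0ℚ * (inv a * inv b)          ≡⟨ ℚₚ.*-zeroˡ (inv a * inv b) ⟩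
    0ℚ                            ∎)
    where
    1≢0 : 1ℚ ≢ 0ℚ
    1≢0 ()
    regroup : ∀ a b a' b' → (a * a') * (b * b') ≡ (a * b) * (a' * b')
    regroup = solve-∀ ℚ-ring

  inv-distrib-* : ∀ a b → inv (a * b) ≡ inv a * inv b
  inv-distrib-* a b = by-cases (a ℚₚ.≟ 0ℚ) (b ℚₚ.≟ 0ℚ)
    where
    by-cases : Dec (a ≡ 0ℚ) → Dec (b ≡ 0ℚ) → inv (a * b) ≡ inv a * inv b
    by-cases (yes refl) _ = trans (cong inv (ℚₚ.*-zeroˡ b)) (sym (ℚₚ.*-zeroˡ (inv b)))
    by-cases (no _) (yes refl) = trans (cong inv (ℚₚ.*-zeroʳ a)) (sym (ℚₚ.*-zeroʳ (inv a)))
    by-cases (no a≢0) (no b≢0) = begin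
      inv (a * b)                                ≡⟨ *-inv-cancelʳ b≢0 (inv (a * b)) ⟨
      inv (a * b) * (b * inv b)                  ≡⟨ *-inv-cancelʳ a≢0 (inv (a * b) * (b * inv b)) ⟨
      inv (a * b) * (b * inv b) * (a * inv a)    ≡⟨ regroup (inv (a * b)) a b (inv a) (inv b) ⟩
      (a * b) * inv (a * b) * (inv a * inv b)    ≡⟨ cong (_* (inv a * inv b)) (inv-inverseʳ (*-≢0 a≢0 b≢0)) ⟩
      1ℚ * (inv a * inv b)                       ≡⟨ ℚₚ.*-identityˡ (inv a * inv b) ⟩
      inv a * inv b                              ∎
      where
      regroup : ∀ i a b a' b' → i * (b * b') * (a * a') ≡ (a * b) * i * (a' * b')
      regroup = solve-∀ ℚ-ring

  partial-fractions : ∀ {a b A B} → (1ℚ - a) * A ≡ 1ℚ → (1ℚ - b) * B ≡ 1ℚ →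
                      a * A + B ≡ (1ℚ - a * b) * A * B
  partial-fractions {a} {b} {A} {B} [1-a]A≡1 [1-b]B≡1 = begin
    a * A + B                              ≡⟨ pad a A B ⟩
    a * A * 1ℚ + 1ℚ * B                    ≡⟨ cong₂ (λ u v → a * A * u + v * B) [1-b]B≡1 [1-a]A≡1 ⟨
    a * A * ((1ℚ - b) * B) + (1ℚ - a) * A * B  ≡⟨ collect a b A B ⟩
    (1ℚ - a * b) * A * B                   ∎
    where
    pad : ∀ a A B → a * A + B ≡ a * A * 1ℚ + 1ℚ * B
    pad = solve-∀ ℚ-ring
    collect : ∀ a b A B → a * A * ((1ℚ - b) * B) + (1ℚ - a) * A * B ≡ (1ℚ - a * b) * A * B
    collect = solve-∀ ℚ-ring

  inv-difference : ∀ {u v w} → u ≢ 0ℚ → v ≢ 0ℚ → inv (w * v) - inv (u * w) ≡ (u - v) * inv (u * (w * v))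
  inv-difference {u} {v} {w} u≢0 v≢0 = begin
    inv (w * v) - inv (u * w)                    ≡⟨ cong₂ _-_ (inv-distrib-* w v) (inv-distrib-* u w) ⟩
    inv w * inv v - inv u * inv w                ≡⟨ pad (inv w) (inv v) (inv u) ⟩
    inv w * inv v * 1ℚ - inv u * inv w * 1ℚ      ≡⟨ cong₂ (λ a b → inv w * inv v * a - inv u * inv w * b)
                                                          (inv-inverseʳ u≢0) (inv-inverseʳ v≢0) ⟨
    inv w * inv v * (u * inv u) - inv u * inv w * (v * inv v)  ≡⟨ collect u v (inv u) (inv v) (inv w) ⟩
    (u - v) * (inv u * (inv w * inv v))          ≡⟨ cong ((u - v) *_) (trans (inv-distrib-* u (w * v))
                                                                             (cong (inv u *_) (inv-distrib-* w v))) ⟨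
    (u - v) * inv (u * (w * v))                  ∎
    where
    pad : ∀ a b c → a * b - c * a ≡ a * b * 1ℚ - c * a * 1ℚ
    pad = solve-∀ ℚ-ring
    collect : ∀ u v iu iv iw → iw * iv * (u * iu) - iu * iw * (v * iv) ≡ (u - v) * (iu * (iw * iv))
    collect = solve-∀ ℚ-ring

  ∑ : ℕ → (ℕ → ℚ) → ℚ
  ∑ zero    f = 0ℚ
  ∑ (suc n) f = f 0 + ∑ n (f ∘ suc)

  ∏ : ℕ → (ℕ → ℚ) → ℚ
  ∏ zero    f = 1ℚ
  ∏ (suc n) f = f 0 * ∏ n (f ∘ suc)

  sumFT≡∑ : ∀ a b f → sumFT a b f ≡ ∑ (suc b ∸ a) (λ d → f (a ℕ.+ d))
  sumFT≡∑ a b f = foldr-applyUpTo (a ℕ.+_) (suc b ∸ a)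
    where
    foldr-applyUpTo : ∀ g n → foldr (λ k acc → f k + acc) 0ℚ (applyUpTo g n) ≡ ∑ n (f ∘ g)
    foldr-applyUpTo g zero    = refl
    foldr-applyUpTo g (suc n) = cong (_+_ (f (g 0))) (foldr-applyUpTo (g ∘ suc) n)

  prodFT≡∏ : ∀ a b f → prodFT a b f ≡ ∏ (suc b ∸ a) (λ d → f (a ℕ.+ d))
  prodFT≡∏ a b f = foldr-applyUpTo (a ℕ.+_) (suc b ∸ a)
    where
    foldr-applyUpTo : ∀ g n → foldr (λ k acc → f k * acc) 1ℚ (applyUpTo g n) ≡ ∏ n (f ∘ g)
    foldr-applyUpTo g zero    = refl
    foldr-applyUpTo g (suc n) = cong (f (g 0) *_) (foldr-applyUpTo (g ∘ suc) n)

  sumFT-+ : ∀ a U f → sumFT a (a ℕ.+ U) f ≡ ∑ (suc U) (λ d → f (a ℕ.+ d))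
  sumFT-+ a U f = trans (sumFT≡∑ a (a ℕ.+ U) f) (cong (λ n → ∑ n (λ d → f (a ℕ.+ d))) count)
    where
    count : suc (a ℕ.+ U) ∸ a ≡ suc U
    count = trans (cong (_∸ a) (sym (ℕₚ.+-suc a U))) (ℕₚ.m+n∸m≡n a (suc U))

  ∑-cong : ∀ n {f g} → (∀ d → d ℕ.< n → f d ≡ g d) → ∑ n f ≡ ∑ n g
  ∑-cong zero    f≡g = refl
  ∑-cong (suc n) f≡g = cong₂ _+_ (f≡g 0 ℕ.z<s) (∑-cong n (λ d d<n → f≡g (suc d) (s≤s d<n)))

  ∏-cong : ∀ n {f g} → (∀ d → d ℕ.< n → f d ≡ g d) → ∏ n f ≡ ∏ n g
  ∏-cong zero    f≡g = refl
  ∏-cong (suc n) f≡g = cong₂ _*_ (f≡g 0 ℕ.z<s) (∏-cong n (λ d d<n → f≡g (suc d) (s≤s d<n)))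

  ∑-sucʳ : ∀ n f → ∑ (suc n) f ≡ ∑ n f + f n
  ∑-sucʳ zero    f = ℚₚ.+-comm (f 0) 0ℚ
  ∑-sucʳ (suc n) f = trans (cong (_+_ (f 0)) (∑-sucʳ n (f ∘ suc))) (sym (ℚₚ.+-assoc (f 0) _ _))

  ∏-sucʳ : ∀ n f → ∏ (suc n) f ≡ ∏ n f * f n
  ∏-sucʳ zero    f = ℚₚ.*-comm (f 0) 1ℚ
  ∏-sucʳ (suc n) f = trans (cong (f 0 *_) (∏-sucʳ n (f ∘ suc))) (sym (ℚₚ.*-assoc (f 0) _ _))

  ∑-zero : ∀ n {f} → (∀ d → d ℕ.< n → f d ≡ 0ℚ) → ∑ n f ≡ 0ℚ
  ∑-zero zero    f≡0 = refl
  ∑-zero (suc n) f≡0 = cong₂ _+_ (f≡0 0 ℕ.z<s) (∑-zero n (λ d d<n → f≡0 (suc d) (s≤s d<n)))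

  ∑-*ˡ : ∀ n c f → ∑ n (λ d → c * f d) ≡ c * ∑ n f
  ∑-*ˡ zero    c f = sym (ℚₚ.*-zeroʳ c)
  ∑-*ˡ (suc n) c f = trans (cong (_+_ (c * f 0)) (∑-*ˡ n c (f ∘ suc))) (sym (ℚₚ.*-distribˡ-+ c (f 0) _))

  ∑-distrib-sub : ∀ n f g → ∑ n (λ d → f d - g d) ≡ ∑ n f - ∑ n g
  ∑-distrib-sub zero    f g = refl
  ∑-distrib-sub (suc n) f g = trans (cong (_+_ (f 0 - g 0)) (∑-distrib-sub n (f ∘ suc) (g ∘ suc)))
                                  (interchange (f 0) (g 0) (∑ n (f ∘ suc)) (∑ n (g ∘ suc)))
    where
    interchange : ∀ a b c d → a - b + (c - d) ≡ a + c - (b + d)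
    interchange = solve-∀ ℚ-ring

  powℕ-+ : ∀ x a b → powℕ x (a ℕ.+ b) ≡ powℕ x a * powℕ x b
  powℕ-+ x zero    b = sym (ℚₚ.*-identityˡ (powℕ x b))
  powℕ-+ x (suc a) b = trans (cong (x *_) (powℕ-+ x a b)) (sym (ℚₚ.*-assoc x (powℕ x a) (powℕ x b)))

  integral : ℤ → ℚ
  integral z = mkℚ z 0 (Cop.sym (Cop.1-coprimeTo ℤ.∣ z ∣))

  tri : ℕ → ℕ
  tri zero    = 0
  tri (suc d) = tri d ℕ.+ d

  tri-double : ∀ d → 2 ℕ.* tri d ℕ.+ d ≡ d ℕ.* d
  tri-double zero    = refl
  tri-double (suc d) = begin
    2 ℕ.* (tri d ℕ.+ d) ℕ.+ suc d        ≡⟨ regroup (tri d) d ⟩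
    (2 ℕ.* tri d ℕ.+ d) ℕ.+ suc (d ℕ.+ d)  ≡⟨ cong (ℕ._+ suc (d ℕ.+ d)) (tri-double d) ⟩
    d ℕ.* d ℕ.+ suc (d ℕ.+ d)            ≡⟨ square d ⟩
    suc d ℕ.* suc d                      ∎
    where
    regroup : ∀ c d → 2 ℕ.* (c ℕ.+ d) ℕ.+ suc d ≡ (2 ℕ.* c ℕ.+ d) ℕ.+ suc (d ℕ.+ d)
    regroup = ℕ-Solver.solve-∀
    square : ∀ d → d ℕ.* d ℕ.+ suc (d ℕ.+ d) ≡ suc d ℕ.* suc d
    square = ℕ-Solver.solve-∀

  half-product : ∀ n d → d ℕ.≤ 2 ℕ.* n ℕ.+ 1 →
    + ((d ℕ.* (2 ℕ.* n ℕ.+ 1 ∸ d)) ℕ./ 2) ≡ + n ℤ.* + d ℤ.- + tri d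
  half-product n d d≤2n+1 = begin
    + (w ℕ./ 2)                          ≡⟨ cong (λ k → + (k ℕ./ 2)) w≡ ⟩
    + ((n ℕ.* d ∸ tri d) ℕ.* 2 ℕ./ 2)    ≡⟨ cong +_ (ℕ.m*n/n≡m (n ℕ.* d ∸ tri d) 2) ⟩
    + (n ℕ.* d ∸ tri d)                  ≡⟨ ℤₚ.⊖-≥ tri≤nd ⟨
    (n ℕ.* d) ℤ.⊖ tri d                  ≡⟨ ℤₚ.m-n≡m⊖n (n ℕ.* d) (tri d) ⟨
    + (n ℕ.* d) ℤ.- + tri d              ≡⟨ cong (ℤ._- + tri d) (ℤₚ.pos-* n d) ⟩
    + n ℤ.* + d ℤ.- + tri d              ∎
    where
    w = d ℕ.* (2 ℕ.* n ℕ.+ 1 ∸ d)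
    expand : ∀ n d → d ℕ.* (2 ℕ.* n ℕ.+ 1) ≡ 2 ℕ.* (n ℕ.* d) ℕ.+ d
    expand = ℕ-Solver.solve-∀
    w+2tri : w ℕ.+ 2 ℕ.* tri d ≡ 2 ℕ.* (n ℕ.* d)
    w+2tri = ℕₚ.+-cancelʳ-≡ d _ _ (begin
      w ℕ.+ 2 ℕ.* tri d ℕ.+ d            ≡⟨ ℕₚ.+-assoc w _ d ⟩
      w ℕ.+ (2 ℕ.* tri d ℕ.+ d)          ≡⟨ cong (w ℕ.+_) (tri-double d) ⟩
      w ℕ.+ d ℕ.* d                      ≡⟨ ℕₚ.*-distribˡ-+ d (2 ℕ.* n ℕ.+ 1 ∸ d) d ⟨
      d ℕ.* (2 ℕ.* n ℕ.+ 1 ∸ d ℕ.+ d)    ≡⟨ cong (d ℕ.*_) (ℕₚ.m∸n+n≡m d≤2n+1) ⟩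
      d ℕ.* (2 ℕ.* n ℕ.+ 1)              ≡⟨ expand n d ⟩
      2 ℕ.* (n ℕ.* d) ℕ.+ d              ∎)
    tri≤nd : tri d ℕ.≤ n ℕ.* d
    tri≤nd = ℕₚ.*-cancelˡ-≤ 2 (subst (2 ℕ.* tri d ℕ.≤_) w+2tri (ℕₚ.m≤n+m (2 ℕ.* tri d) w))
    w≡ : w ≡ (n ℕ.* d ∸ tri d) ℕ.* 2
    w≡ = begin
      w                                  ≡⟨ ℕₚ.m+n∸n≡m w (2 ℕ.* tri d) ⟨
      w ℕ.+ 2 ℕ.* tri d ∸ 2 ℕ.* tri d    ≡⟨ cong (_∸ 2 ℕ.* tri d) w+2tri ⟩
      2 ℕ.* (n ℕ.* d) ∸ 2 ℕ.* tri d      ≡⟨ ℕₚ.*-distribˡ-∸ 2 (n ℕ.* d) (tri d) ⟨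
      2 ℕ.* (n ℕ.* d ∸ tri d)            ≡⟨ ℕₚ.*-comm 2 (n ℕ.* d ∸ tri d) ⟩
      (n ℕ.* d ∸ tri d) ℕ.* 2            ∎

  module _ (q : ℕ) (2≤q : 2 ℕ.≤ q) where

    y : ℕ → ℚ
    y k = inv (mqn q k)

    sgn-+ : ∀ a b → sgn q (a ℕ.+ b) ≡ sgn q a * sgn q b
    sgn-+ = powℕ-+ (- 1ℚ)

    y-+ : ∀ a b → y (a ℕ.+ b) ≡ y a * y b
    y-+ a b = trans (cong inv (powℕ-+ (mq q) a b)) (inv-distrib-* (mqn q a) (mqn q b))

    ipow : ℕ → ℤ
    ipow zero    = + 1
    ipow (suc k) = ℤ.- (+ q) ℤ.* ipow k

    mqn≡ipow : ∀ k → mqn q k ≡ integral (ipow k)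
    mqn≡ipow zero    = refl
    mqn≡ipow (suc k) = begin
      mq q * mqn q k                          ≡⟨ cong₂ _*_ (ℚₚ.↥p/↧p≡p (integral (ℤ.- (+ q)))) (mqn≡ipow k) ⟩
      integral (ℤ.- (+ q)) * integral (ipow k) ≡⟨ ℚₚ.↥p/↧p≡p (integral (ipow (suc k))) ⟩
      integral (ipow (suc k))                 ∎

    ∣ipow∣ : ∀ k → ℤ.∣ ipow k ∣ ≡ q ℕ.^ k
    ∣ipow∣ zero    = refl
    ∣ipow∣ (suc k) = trans (ℤₚ.abs-* (ℤ.- (+ q)) (ipow k)) (cong₂ ℕ._*_ (ℤₚ.∣-i∣≡∣i∣ (+ q)) (∣ipow∣ k))

    ∣↥mqn∣ : ∀ k → ℤ.∣ ℚ.↥ (mqn q k) ∣ ≡ q ℕ.^ k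
    ∣↥mqn∣ k = trans (cong (ℤ.∣_∣ ∘ ℚ.↥_) (mqn≡ipow k)) (∣ipow∣ k)

    mqn≢0 : ∀ k → mqn q k ≢ 0ℚ
    mqn≢0 k mqn≡0 = ℕₚ.<⇒≢ (ℕₚ.<-trans ℕ.z<s 2≤q) (sym (ℕₚ.m^n≡0⇒m≡0 q k q^k≡0))
      where
      q^k≡0 : q ℕ.^ k ≡ 0
      q^k≡0 = trans (sym (∣↥mqn∣ k)) (cong (ℤ.∣_∣ ∘ ℚ.↥_) mqn≡0)

    mqn-suc≢1 : ∀ k → mqn q (suc k) ≢ 1ℚ
    mqn-suc≢1 k mqn≡1 = [ (λ ()) , (λ q≡1 → ℕₚ.<⇒≢ 2≤q (sym q≡1)) ]′ (ℕₚ.m^n≡1⇒n≡0∨m≡1 q (suc k) q^k≡1)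
      where
      q^k≡1 : q ℕ.^ suc k ≡ 1
      q^k≡1 = trans (sym (∣↥mqn∣ (suc k))) (cong (ℤ.∣_∣ ∘ ℚ.↥_) mqn≡1)

    mqn-y : ∀ k → mqn q k * y k ≡ 1ℚ
    mqn-y k = inv-inverseʳ (mqn≢0 k)

    1-y≢0 : ∀ k → 1ℚ - y (suc k) ≢ 0ℚ
    1-y≢0 k 1-y≡0 = mqn-suc≢1 k (begin
      x                          ≡⟨ split x (y (suc k)) ⟩
      x * (1ℚ - y (suc k)) + x * y (suc k) ≡⟨ cong₂ (λ u v → x * u + v) 1-y≡0 (mqn-y (suc k)) ⟩
      x * 0ℚ + 1ℚ                ≡⟨ cong (_+ 1ℚ) (ℚₚ.*-zeroʳ x) ⟩
      1ℚ                         ∎)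
      where
      x = mqn q (suc k)
      split : ∀ a b → a ≡ a * (1ℚ - b) + a * b
      split = solve-∀ ℚ-ring

    mqz-neg : ∀ l → mqz q (ℤ.- (+ l)) ≡ y l
    mqz-neg zero    = refl
    mqz-neg (suc l) = refl

    mqz-pred : ∀ e → mqz q (e ℤ.- + 1) ≡ mqz q e * y 1
    mqz-pred (+ zero)  = sym (ℚₚ.*-identityˡ (y 1))
    mqz-pred (+ suc k) = begin
      mqn q k                        ≡⟨ ℚₚ.*-identityʳ (mqn q k) ⟨
      mqn q k * 1ℚ                   ≡⟨ cong (mqn q k *_) (mqn-y 1) ⟨
      mqn q k * (mqn q 1 * y 1)      ≡⟨ swap (mqn q k) (mqn q 1) (y 1) ⟩
      (mqn q 1 * mqn q k) * y 1      ≡⟨ cong (_* y 1) (powℕ-+ (mq q) 1 k) ⟨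
      mqn q (suc k) * y 1            ∎
      where
      swap : ∀ a b c → a * (b * c) ≡ (b * a) * c
      swap = solve-∀ ℚ-ring
    mqz-pred -[1+ k ] = begin
      inv (mqn q (suc (suc (k ℕ.+ 0))))  ≡⟨ cong (λ j → y (suc (suc j))) (ℕₚ.+-identityʳ k) ⟩
      y (1 ℕ.+ suc k)                    ≡⟨ cong y (ℕₚ.+-comm 1 (suc k)) ⟩
      y (suc k ℕ.+ 1)                    ≡⟨ y-+ (suc k) 1 ⟩
      y (suc k) * y 1                    ∎

    mqz-minus : ∀ e c → mqz q (e ℤ.- + c) ≡ mqz q e * y c
    mqz-minus e zero    = trans (cong (mqz q) (ℤₚ.+-identityʳ e)) (sym (ℚₚ.*-identityʳ (mqz q e)))
    mqz-minus e (suc c) = begin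
      mqz q (e ℤ.- + suc c)              ≡⟨ cong (mqz q) (reassoc e (+ c)) ⟩
      mqz q ((e ℤ.- + c) ℤ.- + 1)        ≡⟨ mqz-pred (e ℤ.- + c) ⟩
      mqz q (e ℤ.- + c) * y 1            ≡⟨ cong (_* y 1) (mqz-minus e c) ⟩
      mqz q e * y c * y 1                ≡⟨ ℚₚ.*-assoc (mqz q e) (y c) (y 1) ⟩
      mqz q e * (y c * y 1)              ≡⟨ cong (mqz q e *_) (trans (cong y (ℕₚ.+-comm 1 c)) (y-+ c 1)) ⟨
      mqz q e * y (suc c)                ∎
      where
      reassoc : ∀ e c → e ℤ.- (+ 1 ℤ.+ c) ≡ (e ℤ.- c) ℤ.- + 1
      reassoc = ℤ-Solver.solve-∀

    poch : ℕ → ℕ → ℚ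
    poch a D = ∏ D (λ j → 1ℚ - y (a ℕ.+ suc j))

    P≡poch : ∀ k → P q k ≡ poch 0 k
    P≡poch k = prodFT≡∏ 1 k (λ l → 1ℚ - mqz q (ℤ.- (+ l)))

    poch-sucʳ : ∀ a D → poch a (suc D) ≡ poch a D * (1ℚ - y (a ℕ.+ suc D))
    poch-sucʳ a D = ∏-sucʳ D _

    poch-sucˡ : ∀ a D → poch a (suc D) ≡ (1ℚ - y (suc a)) * poch (suc a) D
    poch-sucˡ a D = cong₂ _*_ (cong (λ k → 1ℚ - y k) (ℕₚ.+-comm a 1))
                              (∏-cong D (λ j _ → cong (λ k → 1ℚ - y k) (ℕₚ.+-suc a (suc j))))

    poch≢0 : ∀ a D → poch a D ≢ 0ℚ
    poch≢0 a zero    ()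
    poch≢0 a (suc D) = subst (_≢ 0ℚ) (sym (poch-sucˡ a D)) (*-≢0 (1-y≢0 a) (poch≢0 (suc a) D))

    P≢0 : ∀ k → P q k ≢ 0ℚ
    P≢0 k = subst (_≢ 0ℚ) (sym (P≡poch k)) (poch≢0 0 k)

    P-suc : ∀ k → P q (suc k) ≡ P q k * (1ℚ - y (suc k))
    P-suc k = trans (P≡poch (suc k)) (trans (poch-sucʳ 0 k) (cong (_* (1ℚ - y (suc k))) (sym (P≡poch k))))

    P-+ : ∀ a D → P q (a ℕ.+ D) ≡ P q a * poch a D
    P-+ a zero    = trans (cong (P q) (ℕₚ.+-identityʳ a)) (sym (ℚₚ.*-identityʳ (P q a)))
    P-+ a (suc D) = begin
      P q (a ℕ.+ suc D)                          ≡⟨ cong (P q) (ℕₚ.+-suc a D) ⟩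
      P q (suc (a ℕ.+ D))                        ≡⟨ P-suc (a ℕ.+ D) ⟩
      P q (a ℕ.+ D) * (1ℚ - y (suc (a ℕ.+ D)))   ≡⟨ cong₂ (λ u k → u * (1ℚ - y k)) (P-+ a D) (sym (ℕₚ.+-suc a D)) ⟩
      P q a * poch a D * (1ℚ - y (a ℕ.+ suc D))  ≡⟨ ℚₚ.*-assoc (P q a) _ _ ⟩
      P q a * (poch a D * (1ℚ - y (a ℕ.+ suc D))) ≡⟨ cong (P q a *_) (poch-sucʳ a D) ⟨
      P q a * poch a (suc D)                     ∎

    inv-P-suc : ∀ k → inv (P q (suc k)) ≡ inv (P q k) * inv (1ℚ - y (suc k))
    inv-P-suc k = trans (cong inv (P-suc k)) (inv-distrib-* (P q k) _)

    gauss : ℕ → ℕ → ℚ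
    gauss zero    zero    = 1ℚ
    gauss zero    (suc d) = 0ℚ
    gauss (suc m) zero    = 1ℚ
    gauss (suc m) (suc d) = y (suc d) * gauss m (suc d) - y d * gauss m d

    gauss-zeroʳ : ∀ m → gauss m 0 ≡ 1ℚ
    gauss-zeroʳ zero    = refl
    gauss-zeroʳ (suc m) = refl

    gauss-high : ∀ m d → m ℕ.< d → gauss m d ≡ 0ℚ
    gauss-high zero    (suc d) _           = refl
    gauss-high (suc m) (suc d) (s≤s m<d) = begin
      y (suc d) * gauss m (suc d) - y d * gauss m d  ≡⟨ cong₂ (λ u v → y (suc d) * u - y d * v)
                                                          (gauss-high m (suc d) (ℕₚ.m<n⇒m<1+n m<d)) (gauss-high m d m<d) ⟩
      y (suc d) * 0ℚ - y d * 0ℚ                      ≡⟨ annihilate (y (suc d)) (y d) ⟩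
      0ℚ                                             ∎
      where
      annihilate : ∀ a b → a * 0ℚ - b * 0ℚ ≡ 0ℚ
      annihilate = solve-∀ ℚ-ring

    gaussClosed : ℕ → ℕ → ℚ
    gaussClosed m d = sgn q d * y (tri d) * P q m * inv (P q d) * inv (P q (m ∸ d))

    gaussClosed-diag : ∀ m → gaussClosed m m ≡ sgn q m * y (tri m)
    gaussClosed-diag m = begin
      sgn q m * y (tri m) * P q m * inv (P q m) * inv (P q (m ∸ m))
                                                                    ≡⟨ cong (λ k → sgn q m * y (tri m) * P q m * inv (P q m) * inv (P q k)) (ℕₚ.n∸n≡0 m) ⟩
      sgn q m * y (tri m) * P q m * inv (P q m) * 1ℚ                ≡⟨ regroup (sgn q m * y (tri m)) (P q m) (inv (P q m)) ⟩
      sgn q m * y (tri m) * (P q m * inv (P q m))                   ≡⟨ cong (sgn q m * y (tri m) *_) (inv-inverseʳ (P≢0 m)) ⟩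
      sgn q m * y (tri m) * 1ℚ                                      ≡⟨ ℚₚ.*-identityʳ _ ⟩
      sgn q m * y (tri m)                                           ∎
      where
      regroup : ∀ c p p' → c * p * p' * 1ℚ ≡ c * (p * p')
      regroup = solve-∀ ℚ-ring

    gaussClosed-pascal : ∀ m d → d ℕ.< m →
      y (suc d) * gaussClosed m (suc d) - y d * gaussClosed m d ≡ gaussClosed (suc m) (suc d)
    gaussClosed-pascal m d d<m = begin
      a * gaussClosed m (suc d) - y d * gaussClosed m d   ≡⟨ cong₂ (λ u v → a * u - y d * v) upper lower ⟩
      a * - (c * y d * A) - y d * (c * B)                 ≡⟨ factor a c (y d) A B ⟩
      - (c * y d * (a * A + B))                           ≡⟨ cong (λ u → - (c * y d * u))
                                                               (partial-fractions {a} {b} (inv-inverseʳ (1-y≢0 d)) (inv-inverseʳ (1-y≢0 r))) ⟩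
      - (c * y d * ((1ℚ - a * b) * A * B))                ≡⟨ diagonal ⟨
      gaussClosed (suc m) (suc d)                         ∎
      where
      r = m ∸ suc d
      a = y (suc d)
      b = y (suc r)
      A = inv (1ℚ - a)
      B = inv (1ℚ - b)
      c = sgn q d * y (tri d) * P q m * inv (P q d) * inv (P q r)
      m∸d : m ∸ d ≡ suc r
      m∸d = ℕₚ.+-∸-assoc 1 d<m
      upper : gaussClosed m (suc d) ≡ - (c * y d * A)
      upper = begin
        sgn q (suc d) * y (tri d ℕ.+ d) * P q m * inv (P q (suc d)) * inv (P q r)
          ≡⟨ cong₂ (λ u v → sgn q (suc d) * u * P q m * v * inv (P q r)) (y-+ (tri d) d) (inv-P-suc d) ⟩
        (- 1ℚ * sgn q d) * (y (tri d) * y d) * P q m * (inv (P q d) * A) * inv (P q r)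
          ≡⟨ shape (sgn q d) (y (tri d)) (y d) (P q m) (inv (P q d)) A (inv (P q r)) ⟩
        - (c * y d * A)
          ∎
        where
        shape : ∀ s t yd p ip A ir → (- 1ℚ * s) * (t * yd) * p * (ip * A) * ir ≡ - (s * t * p * ip * ir * yd * A)
        shape = solve-∀ ℚ-ring
      lower : gaussClosed m d ≡ c * B
      lower = begin
        sgn q d * y (tri d) * P q m * inv (P q d) * inv (P q (m ∸ d))
          ≡⟨ cong (λ k → sgn q d * y (tri d) * P q m * inv (P q d) * inv (P q k)) m∸d ⟩
        sgn q d * y (tri d) * P q m * inv (P q d) * inv (P q (suc r))
          ≡⟨ cong (sgn q d * y (tri d) * P q m * inv (P q d) *_) (inv-P-suc r) ⟩
        sgn q d * y (tri d) * P q m * inv (P q d) * (inv (P q r) * B)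
          ≡⟨ ℚₚ.*-assoc (sgn q d * y (tri d) * P q m * inv (P q d)) (inv (P q r)) B ⟨
        c * B
          ∎
      diagonal : gaussClosed (suc m) (suc d) ≡ - (c * y d * ((1ℚ - a * b) * A * B))
      diagonal = begin
        sgn q (suc d) * y (tri d ℕ.+ d) * P q (suc m) * inv (P q (suc d)) * inv (P q (m ∸ d))
          ≡⟨ cong₂ (λ u v → sgn q (suc d) * u * P q (suc m) * inv (P q (suc d)) * inv (P q v)) (y-+ (tri d) d) m∸d ⟩
        (- 1ℚ * sgn q d) * (y (tri d) * y d) * P q (suc m) * inv (P q (suc d)) * inv (P q (suc r))
          ≡⟨ cong₂ (λ u v → (- 1ℚ * sgn q d) * (y (tri d) * y d) * u * v * inv (P q (suc r)))
                   (trans (P-suc m) (cong (λ k → P q m * (1ℚ - y k)) 1+m)) (inv-P-suc d) ⟩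
        (- 1ℚ * sgn q d) * (y (tri d) * y d) * (P q m * (1ℚ - y (suc d ℕ.+ suc r))) * (inv (P q d) * A) * inv (P q (suc r))
          ≡⟨ cong ((- 1ℚ * sgn q d) * (y (tri d) * y d) * (P q m * (1ℚ - y (suc d ℕ.+ suc r))) * (inv (P q d) * A) *_)
                  (inv-P-suc r) ⟩
        (- 1ℚ * sgn q d) * (y (tri d) * y d) * (P q m * (1ℚ - y (suc d ℕ.+ suc r))) * (inv (P q d) * A) * (inv (P q r) * B)
          ≡⟨ cong (λ u → (- 1ℚ * sgn q d) * (y (tri d) * y d) * (P q m * (1ℚ - u)) * (inv (P q d) * A) * (inv (P q r) * B))
                  (y-+ (suc d) (suc r)) ⟩
        (- 1ℚ * sgn q d) * (y (tri d) * y d) * (P q m * (1ℚ - a * b)) * (inv (P q d) * A) * (inv (P q r) * B)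
          ≡⟨ shape (sgn q d) (y (tri d)) (y d) (P q m) (inv (P q d)) (inv (P q r)) (a * b) A B ⟩
        - (c * y d * ((1ℚ - a * b) * A * B))
          ∎
        where
        1+m : suc m ≡ suc d ℕ.+ suc r
        1+m = sym (trans (ℕₚ.+-suc (suc d) r) (cong suc (ℕₚ.m+[n∸m]≡n d<m)))
        shape : ∀ s t yd p ip ir ab A B →
          (- 1ℚ * s) * (t * yd) * (p * (1ℚ - ab)) * (ip * A) * (ir * B) ≡ - (s * t * p * ip * ir * yd * ((1ℚ - ab) * A * B))
        shape = solve-∀ ℚ-ring
      factor : ∀ a c yd A B → a * - (c * yd * A) - yd * (c * B) ≡ - (c * yd * (a * A + B))
      factor = solve-∀ ℚ-ring

    gauss≡gaussClosed : ∀ m d → d ℕ.≤ m → gauss m d ≡ gaussClosed m d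
    gauss≡gaussClosed zero    zero    _ = refl
    gauss≡gaussClosed (suc m) zero    _ = sym (trans (drop-units (P q (suc m)) (inv (P q (suc m)))) (inv-inverseʳ (P≢0 (suc m))))
      where
      drop-units : ∀ p p' → 1ℚ * 1ℚ * p * 1ℚ * p' ≡ p * p'
      drop-units = solve-∀ ℚ-ring
    gauss≡gaussClosed (suc m) (suc d) (s≤s d≤m) with ℕₚ.m≤n⇒m<n∨m≡n d≤m
    ... | inj₁ d<m = trans (cong₂ (λ u v → y (suc d) * u - y d * v) (gauss≡gaussClosed m (suc d) d<m) (gauss≡gaussClosed m d d≤m))
                           (gaussClosed-pascal m d d<m)
    ... | inj₂ refl = begin
      y (suc d) * gauss d (suc d) - y d * gauss d d      ≡⟨ cong₂ (λ u v → y (suc d) * u - y d * v) (gauss-high d (suc d) (ℕₚ.n<1+n d))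
                                                              (trans (gauss≡gaussClosed d d d≤m) (gaussClosed-diag d)) ⟩
      y (suc d) * 0ℚ - y d * (sgn q d * y (tri d))        ≡⟨ shape (y (suc d)) (y d) (sgn q d) (y (tri d)) ⟩
      (- 1ℚ * sgn q d) * (y (tri d) * y d)                ≡⟨ cong ((- 1ℚ * sgn q d) *_) (y-+ (tri d) d) ⟨
      sgn q (suc d) * y (tri (suc d))                     ≡⟨ gaussClosed-diag (suc d) ⟨
      gaussClosed (suc d) (suc d)                         ∎
      where
      shape : ∀ a yd s t → a * 0ℚ - yd * (s * t) ≡ (- 1ℚ * s) * (t * yd)
      shape = solve-∀ ℚ-ring

    gaussSum : ℕ → (ℕ → ℚ) → ℚ
    gaussSum m g = ∑ (suc m) (λ d → gauss m d * g d)

    Δ : (ℕ → ℚ) → ℕ → ℚ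
    Δ g d = y d * (g d - g (suc d))

    gaussSum-suc : ∀ m g → gaussSum (suc m) g ≡ gaussSum m (Δ g)
    gaussSum-suc m g = begin
      1ℚ * g 0 + ∑ (suc m) (λ d → (w (suc d) - w d) * g (suc d))
        ≡⟨ cong₂ _+_ (cong (_* g 0) (sym w-bottom)) (trans (∑-cong (suc m) (λ d _ → distrib (w (suc d)) (w d) (g (suc d))))
                                                           (∑-distrib-sub (suc m) (λ d → w (suc d) * g (suc d)) (λ d → w d * g (suc d)))) ⟩
      w 0 * g 0 + (S₁ - S₂)              ≡⟨ ℚₚ.+-assoc (w 0 * g 0) S₁ (- S₂) ⟨
      w 0 * g 0 + S₁ - S₂                ≡⟨ cong (_- S₂) (∑-sucʳ (suc m) (λ d → w d * g d)) ⟩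
      T + w (suc m) * g (suc m) - S₂     ≡⟨ cong (λ u → T + u * g (suc m) - S₂) w-top ⟩
      T + 0ℚ * g (suc m) - S₂            ≡⟨ drop T (g (suc m)) S₂ ⟩
      T - S₂                             ≡⟨ ∑-distrib-sub (suc m) (λ d → w d * g d) (λ d → w d * g (suc d)) ⟨
      ∑ (suc m) (λ d → w d * g d - w d * g (suc d))
        ≡⟨ ∑-cong (suc m) (λ d _ → factor (y d) (gauss m d) (g d) (g (suc d))) ⟩
      gaussSum m (Δ g)                   ∎
      where
      w : ℕ → ℚ
      w d = y d * gauss m d
      T  = ∑ (suc m) (λ d → w d * g d)
      S₁ = ∑ (suc m) (λ d → w (suc d) * g (suc d))
      S₂ = ∑ (suc m) (λ d → w d * g (suc d))
      w-bottom : w 0 ≡ 1ℚ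
      w-bottom = trans (cong (y 0 *_) (gauss-zeroʳ m)) (ℚₚ.*-identityʳ (y 0))
      w-top : w (suc m) ≡ 0ℚ
      w-top = trans (cong (y (suc m) *_) (gauss-high m (suc m) (ℕₚ.n<1+n m))) (ℚₚ.*-zeroʳ (y (suc m)))
      distrib : ∀ a b c → (a - b) * c ≡ a * c - b * c
      distrib = solve-∀ ℚ-ring
      drop : ∀ a b c → a + 0ℚ * b - c ≡ a - c
      drop = solve-∀ ℚ-ring
      factor : ∀ a b c e → a * b * c - a * b * e ≡ b * (a * (c - e))
      factor = solve-∀ ℚ-ring

    gaussSum-zero : ∀ g → gaussSum 0 g ≡ g 0
    gaussSum-zero g = trans (ℚₚ.+-identityʳ (1ℚ * g 0)) (ℚₚ.*-identityˡ (g 0))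

    gaussSum-cong : ∀ m {f g} → (∀ d → d ℕ.≤ m → f d ≡ g d) → gaussSum m f ≡ gaussSum m g
    gaussSum-cong m f≡g = ∑-cong (suc m) (λ d d≤m → cong (gauss m d *_) (f≡g d (ℕₚ.≤-pred d≤m)))

    gaussSum-*ˡ : ∀ m c g → gaussSum m (λ d → c * g d) ≡ c * gaussSum m g
    gaussSum-*ˡ m c g = trans (∑-cong (suc m) (λ d _ → swap (gauss m d) c (g d))) (∑-*ˡ (suc m) c (λ d → gauss m d * g d))
      where
      swap : ∀ a b e → a * (b * e) ≡ b * (a * e)
      swap = solve-∀ ℚ-ring

    y-split : ∀ {A d} → d ℕ.< A → y d * y (suc (A ∸ suc d)) ≡ y A
    y-split {A} {d} d<A = trans (sym (y-+ d _)) (cong y (trans (ℕₚ.+-suc d (A ∸ suc d)) (ℕₚ.m+[n∸m]≡n d<A)))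

    Δ-poch : ∀ A D d → d ℕ.< A →
      Δ (λ e → poch (A ∸ e) (suc D)) d ≡ y A * (1ℚ - y (suc D)) * poch (A ∸ d) D
    Δ-poch A D d d<A = begin
      y d * (poch (A ∸ d) (suc D) - poch a (suc D))
        ≡⟨ cong (λ k → y d * (poch k (suc D) - poch a (suc D))) A∸d ⟩
      y d * (poch (suc a) (suc D) - poch a (suc D))
        ≡⟨ cong₂ (λ u v → y d * (u - v)) (poch-sucʳ (suc a) D) (poch-sucˡ a D) ⟩
      y d * (poch (suc a) D * (1ℚ - y (suc a ℕ.+ suc D)) - (1ℚ - y (suc a)) * poch (suc a) D)
        ≡⟨ cong (λ u → y d * (poch (suc a) D * (1ℚ - u) - (1ℚ - y (suc a)) * poch (suc a) D)) (y-+ (suc a) (suc D)) ⟩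
      y d * (poch (suc a) D * (1ℚ - y (suc a) * y (suc D)) - (1ℚ - y (suc a)) * poch (suc a) D)
        ≡⟨ factor (y d) (poch (suc a) D) (y (suc a)) (y (suc D)) ⟩
      (y d * y (suc a)) * (1ℚ - y (suc D)) * poch (suc a) D
        ≡⟨ cong₂ (λ u k → u * (1ℚ - y (suc D)) * poch k D) (y-split d<A) (sym A∸d) ⟩
      y A * (1ℚ - y (suc D)) * poch (A ∸ d) D
        ∎
      where
      a = A ∸ suc d
      A∸d : A ∸ d ≡ suc a
      A∸d = ℕₚ.+-∸-assoc 1 d<A
      factor : ∀ yd p ya yD → yd * (p * (1ℚ - ya * yD) - (1ℚ - ya) * p) ≡ (yd * ya) * (1ℚ - yD) * p
      factor = solve-∀ ℚ-ring

    gaussSum-poch : ∀ U D A → D ℕ.< U → U ℕ.≤ A → gaussSum U (λ d → poch (A ∸ d) D) ≡ 0ℚ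
    gaussSum-poch (suc U) zero    A _ _ = begin
      gaussSum (suc U) (λ _ → 1ℚ) ≡⟨ gaussSum-suc U (λ _ → 1ℚ) ⟩
      gaussSum U (Δ (λ _ → 1ℚ))   ≡⟨ gaussSum-cong U (λ d _ → ℚₚ.*-zeroʳ (y d)) ⟩
      gaussSum U (λ _ → 0ℚ)       ≡⟨ ∑-zero (suc U) (λ d _ → ℚₚ.*-zeroʳ (gauss U d)) ⟩
      0ℚ                          ∎
    gaussSum-poch (suc U) (suc D) A (s≤s D<U) U<A = begin
      gaussSum (suc U) (λ d → poch (A ∸ d) (suc D))   ≡⟨ gaussSum-suc U (λ d → poch (A ∸ d) (suc D)) ⟩
      gaussSum U (Δ (λ d → poch (A ∸ d) (suc D)))      ≡⟨ gaussSum-cong U (λ d d≤U → Δ-poch A D d (ℕₚ.<-≤-trans (s≤s d≤U) U<A)) ⟩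
      gaussSum U (λ d → c * poch (A ∸ d) D)            ≡⟨ gaussSum-*ˡ U c (λ d → poch (A ∸ d) D) ⟩
      c * gaussSum U (λ d → poch (A ∸ d) D)            ≡⟨ cong (c *_) (gaussSum-poch U D A D<U (ℕₚ.<⇒≤ U<A)) ⟩
      c * 0ℚ                                           ≡⟨ ℚₚ.*-zeroʳ c ⟩
      0ℚ                                               ∎
      where
      c = y A * (1ℚ - y (suc D))

    Δ-invPoch : ∀ A k d → d ℕ.< A →
      Δ (λ e → inv (poch (A ∸ e) (suc k))) d ≡ - (y A * (1ℚ - y (suc k))) * inv (poch (A ∸ suc d) (suc (suc k)))
    Δ-invPoch A k d d<A = begin
      y d * (inv (poch (A ∸ d) (suc k)) - inv (poch a (suc k)))
        ≡⟨ cong (λ j → y d * (inv (poch j (suc k)) - inv (poch a (suc k)))) A∸d ⟩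
      y d * (inv (poch (suc a) (suc k)) - inv (poch a (suc k)))
        ≡⟨ cong₂ (λ p p' → y d * (inv p - inv p')) (poch-sucʳ (suc a) k) (poch-sucˡ a k) ⟩
      y d * (inv (w * v) - inv (u * w))
        ≡⟨ cong (y d *_) (inv-difference {w = w} (1-y≢0 a) (1-y≢0 (a ℕ.+ suc k))) ⟩
      y d * ((u - v) * inv (u * (w * v)))
        ≡⟨ cong₂ (λ z p → y d * ((u - (1ℚ - z)) * inv (u * p))) (y-+ (suc a) (suc k)) (sym (poch-sucʳ (suc a) k)) ⟩
      y d * ((u - (1ℚ - y (suc a) * y (suc k))) * inv (u * poch (suc a) (suc k)))
        ≡⟨ cong (λ p → y d * ((u - (1ℚ - y (suc a) * y (suc k))) * inv p)) (poch-sucˡ a (suc k)) ⟨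
      y d * ((u - (1ℚ - y (suc a) * y (suc k))) * inv (poch a (suc (suc k))))
        ≡⟨ factor (y d) (y (suc a)) (y (suc k)) (inv (poch a (suc (suc k)))) ⟩
      - ((y d * y (suc a)) * (1ℚ - y (suc k))) * inv (poch a (suc (suc k)))
        ≡⟨ cong (λ z → - (z * (1ℚ - y (suc k))) * inv (poch a (suc (suc k)))) (y-split d<A) ⟩
      - (y A * (1ℚ - y (suc k))) * inv (poch a (suc (suc k)))
        ∎
      where
      a = A ∸ suc d
      A∸d : A ∸ d ≡ suc a
      A∸d = ℕₚ.+-∸-assoc 1 d<A
      u = 1ℚ - y (suc a)
      w = poch (suc a) k
      v = 1ℚ - y (suc a ℕ.+ suc k)
      factor : ∀ yd ya yk i → yd * ((1ℚ - ya - (1ℚ - ya * yk)) * i) ≡ - ((yd * ya) * (1ℚ - yk)) * i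
      factor = solve-∀ ℚ-ring

    gaussSum-invPoch : ∀ U A k → U ℕ.≤ A → gaussSum U (λ d → inv (poch (A ∸ d) (suc k)))
      ≡ sgn q U * y (U ℕ.* (A ∸ U) ℕ.+ tri (suc U)) * poch k U * inv (poch (A ∸ U) (suc k ℕ.+ U))
    gaussSum-invPoch zero A k _ = begin
      gaussSum 0 (λ d → inv (poch (A ∸ d) (suc k)))  ≡⟨ gaussSum-zero (λ d → inv (poch (A ∸ d) (suc k))) ⟩
      inv (poch A (suc k))                          ≡⟨ cong (λ j → inv (poch A j)) (ℕₚ.+-identityʳ (suc k)) ⟨
      inv (poch A (suc k ℕ.+ 0))                    ≡⟨ units (inv (poch A (suc k ℕ.+ 0))) ⟩
      1ℚ * 1ℚ * 1ℚ * inv (poch A (suc k ℕ.+ 0))     ∎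
      where
      units : ∀ a → a ≡ 1ℚ * 1ℚ * 1ℚ * a
      units = solve-∀ ℚ-ring
    gaussSum-invPoch (suc U) (suc A) k (s≤s U≤A) = begin
      gaussSum (suc U) g                               ≡⟨ gaussSum-suc U g ⟩
      gaussSum U (Δ g)                                 ≡⟨ gaussSum-cong U (λ d d≤U → Δ-invPoch (suc A) k d (s≤s (ℕₚ.≤-trans d≤U U≤A))) ⟩
      gaussSum U (λ d → c * inv (poch (A ∸ d) (suc (suc k))))
        ≡⟨ gaussSum-*ˡ U c (λ d → inv (poch (A ∸ d) (suc (suc k)))) ⟩
      c * gaussSum U (λ d → inv (poch (A ∸ d) (suc (suc k))))
        ≡⟨ cong (c *_) (gaussSum-invPoch U A (suc k) U≤A) ⟩
      c * (sgn q U * y E * poch (suc k) U * inv (poch (A ∸ U) (suc (suc k) ℕ.+ U)))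
        ≡⟨ shape (y (suc A)) (y (suc k)) (sgn q U) (y E) (poch (suc k) U) (inv (poch (A ∸ U) (suc (suc k) ℕ.+ U))) ⟩
      (- 1ℚ * sgn q U) * (y (suc A) * y E) * ((1ℚ - y (suc k)) * poch (suc k) U) * inv (poch (A ∸ U) (suc (suc k) ℕ.+ U))
        ≡⟨ cong₂ (λ e p → (- 1ℚ * sgn q U) * e * p * inv (poch (A ∸ U) (suc (suc k) ℕ.+ U))) (y-+ (suc A) E) (poch-sucˡ k U) ⟨
      (- 1ℚ * sgn q U) * y (suc A ℕ.+ E) * poch k (suc U) * inv (poch (A ∸ U) (suc (suc k) ℕ.+ U))
        ≡⟨ cong₂ (λ e j → (- 1ℚ * sgn q U) * y e * poch k (suc U) * inv (poch (A ∸ U) j)) exponent (sym (ℕₚ.+-suc (suc k) U)) ⟩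
      sgn q (suc U) * y (suc U ℕ.* (A ∸ U) ℕ.+ tri (suc (suc U))) * poch k (suc U) * inv (poch (A ∸ U) (suc k ℕ.+ suc U))
        ∎
      where
      g = λ d → inv (poch (suc A ∸ d) (suc k))
      c = - (y (suc A) * (1ℚ - y (suc k)))
      E = U ℕ.* (A ∸ U) ℕ.+ tri (suc U)
      expand : ∀ U r t → suc U ℕ.* r ℕ.+ (t ℕ.+ suc U) ≡ suc (U ℕ.+ r) ℕ.+ (U ℕ.* r ℕ.+ t)
      expand = ℕ-Solver.solve-∀
      exponent : suc A ℕ.+ E ≡ suc U ℕ.* (A ∸ U) ℕ.+ tri (suc (suc U))
      exponent = sym (trans (expand U (A ∸ U) (tri (suc U))) (cong (λ j → suc j ℕ.+ E) (ℕₚ.m+[n∸m]≡n U≤A)))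
      shape : ∀ yA yk s e p i → - (yA * (1ℚ - yk)) * (s * e * p * i) ≡ (- 1ℚ * s) * (yA * e) * ((1ℚ - yk) * p) * i
      shape = solve-∀ ℚ-ring

    harm : ℕ → ℚ
    harm k = ∑ k (λ d → 1ℚ ÷' (mqn q (suc d) - 1ℚ))

    harm-term : ∀ k → 1ℚ ÷' (mqn q (suc k) - 1ℚ) ≡ y (suc k) * inv (1ℚ - y (suc k))
    harm-term k = begin
      1ℚ * inv (x - 1ℚ)                  ≡⟨ cong (λ z → 1ℚ * inv z) x-1 ⟩
      1ℚ * inv (x * (1ℚ - y (suc k)))    ≡⟨ ℚₚ.*-identityˡ _ ⟩
      inv (x * (1ℚ - y (suc k)))         ≡⟨ inv-distrib-* x (1ℚ - y (suc k)) ⟩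
      y (suc k) * inv (1ℚ - y (suc k))   ∎
      where
      x = mqn q (suc k)
      expand : ∀ a b → a * (1ℚ - b) ≡ a - a * b
      expand = solve-∀ ℚ-ring
      x-1 : x - 1ℚ ≡ x * (1ℚ - y (suc k))
      x-1 = sym (trans (expand x (y (suc k))) (cong (_-_ x) (mqn-y (suc k))))

    Δ-harm : ∀ A d → d ℕ.< A → Δ (λ e → harm (A ∸ e)) d ≡ y A * inv (poch (A ∸ suc d) 1)
    Δ-harm A d d<A = begin
      y d * (harm (A ∸ d) - harm a)                                ≡⟨ cong (λ j → y d * (harm j - harm a)) A∸d ⟩
      y d * (harm (suc a) - harm a)                                ≡⟨ cong (λ z → y d * (z - harm a)) (∑-sucʳ a _) ⟩
      y d * (harm a + 1ℚ ÷' (mqn q (suc a) - 1ℚ) - harm a)         ≡⟨ cong (λ z → y d * (harm a + z - harm a)) (harm-term a) ⟩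
      y d * (harm a + y (suc a) * inv (1ℚ - y (suc a)) - harm a)   ≡⟨ cancel (y d) (harm a) (y (suc a)) (inv (1ℚ - y (suc a))) ⟩
      (y d * y (suc a)) * inv (1ℚ - y (suc a))                     ≡⟨ cong₂ (λ z p → z * inv p) (y-split d<A) poch-one ⟩
      y A * inv (poch a 1)                                         ∎
      where
      a = A ∸ suc d
      A∸d : A ∸ d ≡ suc a
      A∸d = ℕₚ.+-∸-assoc 1 d<A
      poch-one : 1ℚ - y (suc a) ≡ poch a 1
      poch-one = trans (cong (λ j → 1ℚ - y j) (ℕₚ.+-comm 1 a)) (sym (ℚₚ.*-identityʳ _))
      cancel : ∀ yd h ya i → yd * (h + ya * i - h) ≡ (yd * ya) * i
      cancel = solve-∀ ℚ-ring

    gaussSum-harm : ∀ U A → U ℕ.≤ A → gaussSum (suc U) (λ d → harm (suc A ∸ d))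
      ≡ y (suc A) * (sgn q U * y (U ℕ.* (A ∸ U) ℕ.+ tri (suc U)) * P q U * inv (poch (A ∸ U) (suc U)))
    gaussSum-harm U A U≤A = begin
      gaussSum (suc U) (λ d → harm (suc A ∸ d))          ≡⟨ gaussSum-suc U (λ d → harm (suc A ∸ d)) ⟩
      gaussSum U (Δ (λ d → harm (suc A ∸ d)))            ≡⟨ gaussSum-cong U (λ d d≤U → Δ-harm (suc A) d (s≤s (ℕₚ.≤-trans d≤U U≤A))) ⟩
      gaussSum U (λ d → y (suc A) * inv (poch (A ∸ d) 1)) ≡⟨ gaussSum-*ˡ U (y (suc A)) (λ d → inv (poch (A ∸ d) 1)) ⟩
      y (suc A) * gaussSum U (λ d → inv (poch (A ∸ d) 1)) ≡⟨ cong (y (suc A) *_) (gaussSum-invPoch U A 0 U≤A) ⟩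
      y (suc A) * (sgn q U * y (U ℕ.* (A ∸ U) ℕ.+ tri (suc U)) * poch 0 U * inv (poch (A ∸ U) (suc U)))
        ≡⟨ cong (λ p → y (suc A) * (sgn q U * y (U ℕ.* (A ∸ U) ℕ.+ tri (suc U)) * p * inv (poch (A ∸ U) (suc U)))) (P≡poch U) ⟨
      y (suc A) * (sgn q U * y (U ℕ.* (A ∸ U) ℕ.+ tri (suc U)) * P q U * inv (poch (A ∸ U) (suc U)))
        ∎

    term : ℕ → ℕ → ℕ → ℕ → ℚ
    term N H A d = sgn q d * y (tri d) * inv (P q d) * P q (N ∸ d) * inv (P q (H ∸ d)) * inv (P q (A ∸ d))

    term-comm : ∀ N H A d → term N H A d ≡ term N A H d
    term-comm N H A d = swap (sgn q d * y (tri d) * inv (P q d) * P q (N ∸ d)) (inv (P q (H ∸ d))) (inv (P q (A ∸ d)))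
      where
      swap : ∀ a b c → a * b * c ≡ a * c * b
      swap = solve-∀ ℚ-ring

    term≡gauss*poch : ∀ N U A d → d ℕ.≤ U → U ℕ.≤ A → A ℕ.≤ N →
      term N U A d ≡ inv (P q U) * (gauss U d * poch (A ∸ d) (N ∸ A))
    term≡gauss*poch N U A d d≤U U≤A A≤N = begin
      s * inv (P q d) * P q (N ∸ d) * inv (P q (U ∸ d)) * inv (P q (A ∸ d))
        ≡⟨ cong (λ p → s * inv (P q d) * p * inv (P q (U ∸ d)) * inv (P q (A ∸ d))) (trans (cong (P q) N∸d) (P-+ (A ∸ d) (N ∸ A))) ⟩
      s * inv (P q d) * (P q (A ∸ d) * poch (A ∸ d) (N ∸ A)) * inv (P q (U ∸ d)) * inv (P q (A ∸ d))
        ≡⟨ shape₁ s (inv (P q d)) (P q (A ∸ d)) (poch (A ∸ d) (N ∸ A)) (inv (P q (U ∸ d))) (inv (P q (A ∸ d))) ⟩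
      X * (P q (A ∸ d) * inv (P q (A ∸ d)))  ≡⟨ *-inv-cancelʳ (P≢0 (A ∸ d)) X ⟩
      X                                      ≡⟨ *-inv-cancelʳ (P≢0 U) X ⟨
      X * (P q U * inv (P q U))              ≡⟨ shape₂ s (inv (P q d)) (poch (A ∸ d) (N ∸ A)) (inv (P q (U ∸ d))) (P q U) (inv (P q U)) ⟩
      inv (P q U) * (gaussClosed U d * poch (A ∸ d) (N ∸ A))
        ≡⟨ cong (λ g → inv (P q U) * (g * poch (A ∸ d) (N ∸ A))) (gauss≡gaussClosed U d d≤U) ⟨
      inv (P q U) * (gauss U d * poch (A ∸ d) (N ∸ A))
        ∎
      where
      s = sgn q d * y (tri d)
      X = s * inv (P q d) * inv (P q (U ∸ d)) * poch (A ∸ d) (N ∸ A)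
      N∸d : N ∸ d ≡ (A ∸ d) ℕ.+ (N ∸ A)
      N∸d = begin
        N ∸ d                     ≡⟨ cong (_∸ d) (ℕₚ.m∸n+n≡m A≤N) ⟨
        (N ∸ A) ℕ.+ A ∸ d         ≡⟨ ℕₚ.+-∸-assoc (N ∸ A) (ℕₚ.≤-trans d≤U U≤A) ⟩
        (N ∸ A) ℕ.+ (A ∸ d)       ≡⟨ ℕₚ.+-comm (N ∸ A) (A ∸ d) ⟩
        (A ∸ d) ℕ.+ (N ∸ A)       ∎
      shape₁ : ∀ s ipd pa r ipu ipa → s * ipd * (pa * r) * ipu * ipa ≡ s * ipd * ipu * r * (pa * ipa)
      shape₁ = solve-∀ ℚ-ring
      shape₂ : ∀ s ipd r ipu pu ipU → s * ipd * ipu * r * (pu * ipU) ≡ ipU * (s * pu * ipd * ipu * r)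
      shape₂ = solve-∀ ℚ-ring

    ∑term≡0 : ∀ N U A → U ℕ.≤ A → A ℕ.≤ N → N ∸ A ℕ.< U → ∑ (suc U) (term N U A) ≡ 0ℚ
    ∑term≡0 N U A U≤A A≤N N∸A<U = begin
      ∑ (suc U) (term N U A)
        ≡⟨ ∑-cong (suc U) (λ d d≤U → term≡gauss*poch N U A d (ℕₚ.≤-pred d≤U) U≤A A≤N) ⟩
      ∑ (suc U) (λ d → inv (P q U) * (gauss U d * poch (A ∸ d) (N ∸ A)))
        ≡⟨ ∑-*ˡ (suc U) (inv (P q U)) (λ d → gauss U d * poch (A ∸ d) (N ∸ A)) ⟩
      inv (P q U) * gaussSum U (λ d → poch (A ∸ d) (N ∸ A))
        ≡⟨ cong (inv (P q U) *_) (gaussSum-poch U (N ∸ A) A N∸A<U U≤A) ⟩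
      inv (P q U) * 0ℚ
        ≡⟨ ℚₚ.*-zeroʳ (inv (P q U)) ⟩
      0ℚ
        ∎

    ∑term-⊓≡0 : ∀ N H A → H ℕ.≤ N → A ℕ.≤ N → N ∸ H ℕ.< A → N ∸ A ℕ.< H →
      ∑ (suc (A ⊓ H)) (term N H A) ≡ 0ℚ
    ∑term-⊓≡0 N H A H≤N A≤N N∸H<A N∸A<H with ℕₚ.≤-total A H
    ... | inj₁ A≤H rewrite ℕₚ.m≤n⇒m⊓n≡m A≤H =
      trans (∑-cong (suc A) (λ d _ → term-comm N H A d)) (∑term≡0 N A H A≤H H≤N N∸H<A)
    ... | inj₂ H≤A rewrite ℕₚ.m≥n⇒m⊓n≡n H≤A = ∑term≡0 N H A H≤A A≤N N∸A<H

    term-diag : ∀ m H d → d ℕ.≤ H → term m H m d ≡ inv (P q H) * gauss H d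
    term-diag m H d d≤H = begin
      s * inv (P q d) * P q (m ∸ d) * inv (P q (H ∸ d)) * inv (P q (m ∸ d))
        ≡⟨ shape₁ s (inv (P q d)) (P q (m ∸ d)) (inv (P q (H ∸ d))) (inv (P q (m ∸ d))) ⟩
      X * (P q (m ∸ d) * inv (P q (m ∸ d)))  ≡⟨ *-inv-cancelʳ (P≢0 (m ∸ d)) X ⟩
      X                                      ≡⟨ *-inv-cancelʳ (P≢0 H) X ⟨
      X * (P q H * inv (P q H))              ≡⟨ shape₂ s (inv (P q d)) (inv (P q (H ∸ d))) (P q H) (inv (P q H)) ⟩
      inv (P q H) * gaussClosed H d          ≡⟨ cong (inv (P q H) *_) (gauss≡gaussClosed H d d≤H) ⟨
      inv (P q H) * gauss H d                ∎
      where
      s = sgn q d * y (tri d)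
      X = s * inv (P q d) * inv (P q (H ∸ d))
      shape₁ : ∀ s ipd pm iph ipm → s * ipd * pm * iph * ipm ≡ s * ipd * iph * (pm * ipm)
      shape₁ = solve-∀ ℚ-ring
      shape₂ : ∀ s ipd iph ph iPH → s * ipd * iph * (ph * iPH) ≡ iPH * (s * ph * ipd * iph)
      shape₂ = solve-∀ ℚ-ring

    ≤-2n+1 : ∀ {d n} → d ℕ.≤ n → d ℕ.≤ 2 ℕ.* n ℕ.+ 1
    ≤-2n+1 {n = n} d≤n = ℕₚ.≤-trans d≤n (ℕₚ.≤-trans (ℕₚ.m≤m+n n (n ℕ.+ 0)) (ℕₚ.m≤m+n (2 ℕ.* n) 1))

    Mexp-shift : ∀ n h c s d → d ℕ.≤ n → Mexp q n h c (s ℕ.+ d) s ≡ Mexp q n h c s s ℤ.- + tri d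
    Mexp-shift n h c s d d≤n
      rewrite ℕₚ.m+n∸m≡n s d | ℕₚ.n∸n≡0 s | half-product n d (≤-2n+1 d≤n) | ℤₚ.pos-+ s d
      = regroup (+ n) (+ h) (+ s) (+ d) (+ tri d) (+ s ℤ.* (+ 2 ℤ.* + n ℤ.- + 2 ℤ.* + c ℤ.- + s))
      where
      regroup : ∀ n h s d t w → n ℤ.* (h ℤ.- (s ℤ.+ d)) ℤ.+ (n ℤ.* d ℤ.- t) ℤ.- h ℤ.* h ℤ.+ w
                              ≡ n ℤ.* (h ℤ.- s) ℤ.+ + 0 ℤ.- h ℤ.* h ℤ.+ w ℤ.- t
      regroup = ℤ-Solver.solve-∀

    mqz-Mexp-shift : ∀ n h c s d → d ℕ.≤ n → mqz q (Mexp q n h c (s ℕ.+ d) s) ≡ mqz q (Mexp q n h c s s) * y (tri d)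
    mqz-Mexp-shift n h c s d d≤n = trans (cong (mqz q) (Mexp-shift n h c s d d≤n)) (mqz-minus (Mexp q n h c s s) (tri d))

    M₀ : ℕ → ℕ → ℕ → ℕ → ℕ → ℚ
    M₀ n h t c s = mqz q (Mexp q n h c s s) * sgn q (s ℕ.+ h) * inv (P q (n ∸ h)) * inv (P q h)
                   * prodFT (suc s) h (λ l → 1ℚ - mqz q (ℤ.- (+ l))) * P q c * P q t * inv (P q (t ∸ s))

    M-split : ∀ n h t c s d → d ℕ.≤ n →
      M q n h 0 t c (s ℕ.+ d) s ≡ M₀ n h t c s * term (n ∸ s) (h ∸ s) c d * Cc q (+ suc h ℤ.- + s) 0 (t ∸ s) (c ∸ d)
    M-split n h t c s d d≤n = unfolded
      where
      PF = prodFT (suc s) h (λ l → 1ℚ - mqz q (ℤ.- (+ l)))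
      C : ℕ → ℚ
      C = Cc q (+ suc h ℤ.- + s) 0 (t ∸ s)
      unfolded : mqz q (Mexp q n h c (s ℕ.+ d) s) * sgn q (s ℕ.+ d ℕ.+ h)
                 * (P q (n ∸ (s ℕ.+ d)) * inv (P q (n ∸ h) * P q h))
                 * (PF * inv (P q (h ∸ (s ℕ.+ d)) * P q (s ℕ.+ d ∸ s)))
                 * ((P q c * P q t) * inv (P q (c ℕ.+ s ∸ (s ℕ.+ d)) * P q (t ∸ s)))
                 * C (c ℕ.+ s ∸ (s ℕ.+ d))
               ≡ M₀ n h t c s * term (n ∸ s) (h ∸ s) c d * C (c ∸ d)
      unfolded
        rewrite mqz-Mexp-shift n h c s d d≤n
              | ℕₚ.m+n∸m≡n s d
              | sym (ℕₚ.∸-+-assoc n s d)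
              | sym (ℕₚ.∸-+-assoc h s d)
              | ℕₚ.+-comm c s
              | ℕₚ.[m+n]∸[m+o]≡n∸o s c d
              | trans (ℕₚ.+-assoc s d h) (trans (cong (s ℕ.+_) (ℕₚ.+-comm d h)) (sym (ℕₚ.+-assoc s h d)))
              | sgn-+ (s ℕ.+ h) d
              | inv-distrib-* (P q (n ∸ h)) (P q h)
              | inv-distrib-* (P q ((h ∸ s) ∸ d)) (P q d)
              | inv-distrib-* (P q (c ∸ d)) (P q (t ∸ s))
        = shape (mqz q (Mexp q n h c s s)) (y (tri d)) (sgn q (s ℕ.+ h)) (sgn q d) (P q ((n ∸ s) ∸ d))
                (inv (P q (n ∸ h))) (inv (P q h)) PF (inv (P q ((h ∸ s) ∸ d))) (inv (P q d))
                (P q c) (P q t) (inv (P q (c ∸ d))) (inv (P q (t ∸ s))) (C (c ∸ d))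
        where
        shape : ∀ z yt ssh sd pn ipnh iph pf ipd' ipd pc pt ipcd ipts cc →
          z * yt * (ssh * sd) * (pn * (ipnh * iph)) * (pf * (ipd' * ipd)) * ((pc * pt) * (ipcd * ipts)) * cc
          ≡ (z * ssh * ipnh * iph * pf * pc * pt * ipts) * (sd * yt * ipd * pn * ipd' * ipcd) * cc
        shape = solve-∀ ℚ-ring

    𝒞-const : ∀ j b z z' → 0 ℕ.< b → Cc q j 0 b z ≡ Cc q j 0 b z'
    𝒞-const j (suc b) z z' _ = refl

    𝒞≡harm : ∀ j k → Cc q j 0 0 k ≡ harm k
    𝒞≡harm j k = sumFT≡∑ 1 k (λ l → 1ℚ ÷' (mqn q l - 1ℚ))

    innerSum : ℕ → ℕ → ℕ → ℕ → ℚ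
    innerSum n h t s = sumFT s ((s ℕ.+ (n ∸ t)) ⊓ h) (λ i → M q n h 0 t (n ∸ t) i s)

    innerSum-split : ∀ n h t s → s ℕ.≤ h → h ℕ.≤ n →
      innerSum n h t s ≡ ∑ (suc ((n ∸ t) ⊓ (h ∸ s)))
        (λ d → M₀ n h t (n ∸ t) s * term (n ∸ s) (h ∸ s) (n ∸ t) d * Cc q (+ suc h ℤ.- + s) 0 (t ∸ s) ((n ∸ t) ∸ d))
    innerSum-split n h t s s≤h h≤n = begin
      sumFT s ((s ℕ.+ m) ⊓ h) f         ≡⟨ cong (λ k → sumFT s k f) upper-limit ⟩
      sumFT s (s ℕ.+ U) f               ≡⟨ sumFT-+ s U f ⟩
      ∑ (suc U) (λ d → f (s ℕ.+ d))     ≡⟨ ∑-cong (suc U) (λ d d≤U → M-split n h t m s d (d≤n (ℕₚ.≤-pred d≤U))) ⟩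
      ∑ (suc U) (λ d → M₀ n h t m s * term (n ∸ s) (h ∸ s) m d * Cc q (+ suc h ℤ.- + s) 0 (t ∸ s) (m ∸ d)) ∎
      where
      m = n ∸ t
      U = m ⊓ (h ∸ s)
      f = λ i → M q n h 0 t m i s
      upper-limit : (s ℕ.+ m) ⊓ h ≡ s ℕ.+ U
      upper-limit = trans (cong ((s ℕ.+ m) ⊓_) (sym (ℕₚ.m+[n∸m]≡n s≤h))) (sym (ℕₚ.+-distribˡ-⊓ s m (h ∸ s)))
      d≤n : ∀ {d} → d ℕ.≤ U → d ℕ.≤ n
      d≤n d≤U = ℕₚ.≤-trans d≤U (ℕₚ.≤-trans (ℕₚ.m⊓n≤n m (h ∸ s)) (ℕₚ.≤-trans (ℕₚ.m∸n≤m h s) h≤n))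

    innerSum-off : ∀ n h t s → s ℕ.< t → t ℕ.< h → h ℕ.≤ n → innerSum n h t s ≡ 0ℚ
    innerSum-off n h t s s<t t<h h≤n = begin
      innerSum n h t s
        ≡⟨ innerSum-split n h t s (ℕₚ.≤-trans s≤t (ℕₚ.<⇒≤ t<h)) h≤n ⟩
      ∑ (suc (A ⊓ H)) (λ d → M₀ n h t A s * term N H A d * C (A ∸ d))
        ≡⟨ ∑-cong (suc (A ⊓ H)) (λ d _ → trans (cong (M₀ n h t A s * term N H A d *_) (𝒞-const _ (t ∸ s) (A ∸ d) 0 (ℕₚ.m<n⇒0<n∸m s<t)))
                                             (swap (M₀ n h t A s) (term N H A d) (C 0))) ⟩
      ∑ (suc (A ⊓ H)) (λ d → (M₀ n h t A s * C 0) * term N H A d)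
        ≡⟨ ∑-*ˡ (suc (A ⊓ H)) (M₀ n h t A s * C 0) (term N H A) ⟩
      (M₀ n h t A s * C 0) * ∑ (suc (A ⊓ H)) (term N H A)
        ≡⟨ cong ((M₀ n h t A s * C 0) *_) (∑term-⊓≡0 N H A H≤N A≤N N∸H<A N∸A<H) ⟩
      (M₀ n h t A s * C 0) * 0ℚ
        ≡⟨ ℚₚ.*-zeroʳ (M₀ n h t A s * C 0) ⟩
      0ℚ ∎
      where
      N = n ∸ s
      H = h ∸ s
      A = n ∸ t
      C = Cc q (+ suc h ℤ.- + s) 0 (t ∸ s)
      s≤t = ℕₚ.<⇒≤ s<t
      t≤n = ℕₚ.≤-trans (ℕₚ.<⇒≤ t<h) h≤n
      H≤N : H ℕ.≤ N
      H≤N = ℕₚ.∸-monoˡ-≤ s h≤n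
      A≤N : A ℕ.≤ N
      A≤N = ℕₚ.∸-monoʳ-≤ n s≤t
      N∸H≡n∸h : N ∸ H ≡ n ∸ h
      N∸H≡n∸h = trans (ℕₚ.∸-+-assoc n s H) (cong (n ∸_) (ℕₚ.m+[n∸m]≡n (ℕₚ.≤-trans s≤t (ℕₚ.<⇒≤ t<h))))
      N≡A+[t∸s] : N ≡ A ℕ.+ (t ∸ s)
      N≡A+[t∸s] = trans (cong (_∸ s) (sym (ℕₚ.m∸n+n≡m t≤n))) (ℕₚ.+-∸-assoc A s≤t)
      N∸H<A : N ∸ H ℕ.< A
      N∸H<A = subst (ℕ._< A) (sym N∸H≡n∸h) (ℕₚ.∸-monoʳ-< t<h h≤n)
      N∸A<H : N ∸ A ℕ.< H
      N∸A<H = subst (ℕ._< H) (sym (trans (cong (_∸ A) N≡A+[t∸s]) (ℕₚ.m+n∸m≡n A (t ∸ s)))) (ℕₚ.∸-monoˡ-< t<h s≤t)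
      swap : ∀ a b c → a * b * c ≡ (a * c) * b
      swap = solve-∀ ℚ-ring

    innerSum-diag : ∀ n h t → t ℕ.≤ h → h ℕ.≤ n →
      innerSum n h t t ≡ (M₀ n h t (n ∸ t) t * inv (P q (h ∸ t))) * gaussSum (h ∸ t) (λ d → harm ((n ∸ t) ∸ d))
    innerSum-diag n h t t≤h h≤n = begin
      innerSum n h t t
        ≡⟨ innerSum-split n h t t t≤h h≤n ⟩
      ∑ (suc (m ⊓ H)) (λ d → M₀ n h t m t * term m H m d * C (t ∸ t) (m ∸ d))
        ≡⟨ cong (λ k → ∑ (suc k) (λ d → M₀ n h t m t * term m H m d * C (t ∸ t) (m ∸ d))) (ℕₚ.m≥n⇒m⊓n≡n H≤m) ⟩
      ∑ (suc H) (λ d → M₀ n h t m t * term m H m d * C (t ∸ t) (m ∸ d))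
        ≡⟨ ∑-cong (suc H) (λ d d≤H → summand d (ℕₚ.≤-pred d≤H)) ⟩
      ∑ (suc H) (λ d → (M₀ n h t m t * inv (P q H)) * (gauss H d * harm (m ∸ d)))
        ≡⟨ ∑-*ˡ (suc H) (M₀ n h t m t * inv (P q H)) (λ d → gauss H d * harm (m ∸ d)) ⟩
      (M₀ n h t m t * inv (P q H)) * gaussSum H (λ d → harm (m ∸ d)) ∎
      where
      m = n ∸ t
      H = h ∸ t
      C = Cc q (+ suc h ℤ.- + t) 0
      H≤m : H ℕ.≤ m
      H≤m = ℕₚ.∸-monoˡ-≤ t h≤n
      reassoc : ∀ a p g e → a * (p * g) * e ≡ (a * p) * (g * e)
      reassoc = solve-∀ ℚ-ring
      summand : ∀ d → d ℕ.≤ H → M₀ n h t m t * term m H m d * C (t ∸ t) (m ∸ d) ≡ (M₀ n h t m t * inv (P q H)) * (gauss H d * harm (m ∸ d))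
      summand d d≤H = begin
        M₀ n h t m t * term m H m d * C (t ∸ t) (m ∸ d)
          ≡⟨ cong₂ (λ u v → M₀ n h t m t * u * v) (term-diag m H d d≤H) (trans (cong (λ j → C j (m ∸ d)) (ℕₚ.n∸n≡0 t)) (𝒞≡harm (+ suc h ℤ.- + t) (m ∸ d))) ⟩
        M₀ n h t m t * (inv (P q H) * gauss H d) * harm (m ∸ d)
          ≡⟨ reassoc (M₀ n h t m t) (inv (P q H)) (gauss H d) (harm (m ∸ d)) ⟩
        (M₀ n h t m t * inv (P q H)) * (gauss H d * harm (m ∸ d)) ∎

    tailTerm : ℕ → ℕ → ℚ
    tailTerm h t = mqz q (ℤ.- (+ ((h ∸ t) ℕ.* (h ℕ.+ t ℕ.+ 1) ℕ./ 2))) ÷' (1ℚ - mqz q (ℤ.- (+ (h ∸ t))))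

    tailExponent : ℕ → ℕ → ℕ
    tailExponent t b = t ℕ.* suc b ℕ.+ suc b ℕ.+ tri (suc b)

    tailTerm≡ : ∀ t b → tailTerm (t ℕ.+ suc b) t ≡ y (tailExponent t b) * inv (1ℚ - y (suc b))
    tailTerm≡ t b rewrite ℕₚ.m+n∸m≡n t (suc b) =
      cong₂ (λ u v → u * inv (1ℚ - v)) (trans (cong (λ k → mqz q (ℤ.- (+ k))) halved) (mqz-neg (tailExponent t b))) (mqz-neg (suc b))
      where
      B = suc b
      expand₁ : ∀ t B → B ℕ.* (t ℕ.+ B ℕ.+ t ℕ.+ 1) ≡ B ℕ.* (2 ℕ.* t ℕ.+ 1) ℕ.+ B ℕ.* B
      expand₁ = ℕ-Solver.solve-∀
      expand₂ : ∀ t B c → B ℕ.* (2 ℕ.* t ℕ.+ 1) ℕ.+ (2 ℕ.* c ℕ.+ B) ≡ (t ℕ.* B ℕ.+ B ℕ.+ c) ℕ.* 2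
      expand₂ = ℕ-Solver.solve-∀
      doubled : B ℕ.* (t ℕ.+ B ℕ.+ t ℕ.+ 1) ≡ tailExponent t b ℕ.* 2
      doubled = trans (expand₁ t B) (trans (cong (B ℕ.* (2 ℕ.* t ℕ.+ 1) ℕ.+_) (sym (tri-double B))) (expand₂ t B (tri B)))
      halved : B ℕ.* (t ℕ.+ B ℕ.+ t ℕ.+ 1) ℕ./ 2 ≡ tailExponent t b
      halved = trans (cong (ℕ._/ 2) doubled) (ℕ.m*n/n≡m (tailExponent t b) 2)

    Mexp-diag : ∀ t b L →
      Mexp q (t ℕ.+ suc b ℕ.+ L) (t ℕ.+ suc b) (suc (b ℕ.+ L)) t t ℤ.- + suc (b ℕ.+ L) ℤ.- + (b ℕ.* L ℕ.+ tri (suc b))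
      ≡ ℤ.- + tailExponent t b
    Mexp-diag t b L rewrite ℕₚ.n∸n≡0 t = identity en eh em eE eE₂
      where
      +suc : ∀ k → + suc k ≡ + k ℤ.+ + 1
      +suc k = trans (cong +_ (ℕₚ.+-comm 1 k)) (ℤₚ.pos-+ k 1)
      eh : + (t ℕ.+ suc b) ≡ + t ℤ.+ (+ b ℤ.+ + 1)
      eh = trans (ℤₚ.pos-+ t (suc b)) (cong (ℤ._+_ (+ t)) (+suc b))
      en : + (t ℕ.+ suc b ℕ.+ L) ≡ + t ℤ.+ (+ b ℤ.+ + 1) ℤ.+ + L
      en = trans (ℤₚ.pos-+ (t ℕ.+ suc b) L) (cong (ℤ._+ + L) eh)
      em : + suc (b ℕ.+ L) ≡ + b ℤ.+ + L ℤ.+ + 1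
      em = trans (+suc (b ℕ.+ L)) (cong (ℤ._+ + 1) (ℤₚ.pos-+ b L))
      eE : + (b ℕ.* L ℕ.+ tri (suc b)) ≡ + b ℤ.* + L ℤ.+ + tri (suc b)
      eE = trans (ℤₚ.pos-+ (b ℕ.* L) (tri (suc b))) (cong (ℤ._+ + tri (suc b)) (ℤₚ.pos-* b L))
      eE₂ : + tailExponent t b ≡ + t ℤ.* (+ b ℤ.+ + 1) ℤ.+ (+ b ℤ.+ + 1) ℤ.+ + tri (suc b)
      eE₂ = trans (ℤₚ.pos-+ (t ℕ.* suc b ℕ.+ suc b) (tri (suc b)))
                  (cong (ℤ._+ + tri (suc b)) (trans (ℤₚ.pos-+ (t ℕ.* suc b) (suc b))
                        (cong₂ ℤ._+_ (trans (ℤₚ.pos-* t (suc b)) (cong (ℤ._*_ (+ t)) (+suc b))) (+suc b))))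
      polynomial : ∀ T B L C →
        (T ℤ.+ (B ℤ.+ + 1) ℤ.+ L) ℤ.* ((T ℤ.+ (B ℤ.+ + 1)) ℤ.- T) ℤ.+ + 0 ℤ.- (T ℤ.+ (B ℤ.+ + 1)) ℤ.* (T ℤ.+ (B ℤ.+ + 1))
        ℤ.+ T ℤ.* (+ 2 ℤ.* (T ℤ.+ (B ℤ.+ + 1) ℤ.+ L) ℤ.- + 2 ℤ.* (B ℤ.+ L ℤ.+ + 1) ℤ.- T) ℤ.- (B ℤ.+ L ℤ.+ + 1) ℤ.- (B ℤ.* L ℤ.+ C)
        ≡ ℤ.- (T ℤ.* (B ℤ.+ + 1) ℤ.+ (B ℤ.+ + 1) ℤ.+ C)
      polynomial = ℤ-Solver.solve-∀
      identity : ∀ {N H M E E₂} → N ≡ + t ℤ.+ (+ b ℤ.+ + 1) ℤ.+ + L → H ≡ + t ℤ.+ (+ b ℤ.+ + 1) → M ≡ + b ℤ.+ + L ℤ.+ + 1 →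
        E ≡ + b ℤ.* + L ℤ.+ + tri (suc b) → E₂ ≡ + t ℤ.* (+ b ℤ.+ + 1) ℤ.+ (+ b ℤ.+ + 1) ℤ.+ + tri (suc b) →
        N ℤ.* (H ℤ.- + t) ℤ.+ + 0 ℤ.- H ℤ.* H ℤ.+ + t ℤ.* (+ 2 ℤ.* N ℤ.- + 2 ℤ.* M ℤ.- + t) ℤ.- M ℤ.- E ≡ ℤ.- E₂
      identity refl refl refl refl refl = polynomial (+ t) (+ b) (+ L) (+ tri (suc b))

    sgn-double : ∀ k → sgn q (k ℕ.+ k) ≡ 1ℚ
    sgn-double zero    = refl
    sgn-double (suc k) = begin
      - 1ℚ * sgn q (k ℕ.+ suc k)        ≡⟨ cong (λ j → - 1ℚ * sgn q j) (ℕₚ.+-suc k k) ⟩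
      - 1ℚ * (- 1ℚ * sgn q (k ℕ.+ k))   ≡⟨ cong (λ z → - 1ℚ * (- 1ℚ * z)) (sgn-double k) ⟩
      1ℚ                                ∎

    sgn-diag : ∀ t b → sgn q (t ℕ.+ (t ℕ.+ suc b)) * sgn q b ≡ - 1ℚ
    sgn-diag t b = begin
      sgn q (t ℕ.+ (t ℕ.+ suc b)) * sgn q b   ≡⟨ sgn-+ (t ℕ.+ (t ℕ.+ suc b)) b ⟨
      sgn q (t ℕ.+ (t ℕ.+ suc b) ℕ.+ b)       ≡⟨ cong (sgn q) (odd t b) ⟩
      - 1ℚ * sgn q ((t ℕ.+ b) ℕ.+ (t ℕ.+ b))  ≡⟨ cong (- 1ℚ *_) (sgn-double (t ℕ.+ b)) ⟩
      - 1ℚ                                    ∎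
      where
      odd : ∀ t b → t ℕ.+ (t ℕ.+ suc b) ℕ.+ b ≡ suc ((t ℕ.+ b) ℕ.+ (t ℕ.+ b))
      odd = ℕ-Solver.solve-∀

    prodFT≡poch : ∀ t b → prodFT (suc t) (t ℕ.+ suc b) (λ l → 1ℚ - mqz q (ℤ.- (+ l))) ≡ poch t (suc b)
    prodFT≡poch t b = begin
      prodFT (suc t) (t ℕ.+ suc b) (λ l → 1ℚ - mqz q (ℤ.- (+ l)))
        ≡⟨ prodFT≡∏ (suc t) (t ℕ.+ suc b) (λ l → 1ℚ - mqz q (ℤ.- (+ l))) ⟩
      ∏ ((t ℕ.+ suc b) ∸ t) (λ d → 1ℚ - y (suc (t ℕ.+ d)))
        ≡⟨ cong (λ k → ∏ k (λ d → 1ℚ - y (suc (t ℕ.+ d)))) (ℕₚ.m+n∸m≡n t (suc b)) ⟩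
      ∏ (suc b) (λ d → 1ℚ - y (suc (t ℕ.+ d)))
        ≡⟨ ∏-cong (suc b) (λ d _ → cong (λ k → 1ℚ - y k) (sym (ℕₚ.+-suc t d))) ⟩
      poch t (suc b) ∎

    M₀-diag : ∀ t b L →
      M₀ (t ℕ.+ suc b ℕ.+ L) (t ℕ.+ suc b) t (suc (b ℕ.+ L)) t * inv (P q (suc b))
        * (y (suc (b ℕ.+ L)) * (sgn q b * y (b ℕ.* L ℕ.+ tri (suc b)) * P q b * inv (poch L (suc b))))
      ≡ (mqz q (Mexp q (t ℕ.+ suc b ℕ.+ L) (t ℕ.+ suc b) (suc (b ℕ.+ L)) t t) * y (suc (b ℕ.+ L)) * y (b ℕ.* L ℕ.+ tri (suc b)))
        * (sgn q (t ℕ.+ (t ℕ.+ suc b)) * sgn q b) * inv (1ℚ - y (suc b))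
    M₀-diag t b L = unfolded (mqz q (Mexp q n h m t t))
      where
      h = t ℕ.+ suc b
      n = h ℕ.+ L
      m = suc (b ℕ.+ L)
      E = b ℕ.* L ℕ.+ tri (suc b)
      P-m : P q m ≡ P q L * poch L (suc b)
      P-m = trans (cong (P q) (trans (cong suc (ℕₚ.+-comm b L)) (sym (ℕₚ.+-suc L b)))) (P-+ L (suc b))
      unfolded : ∀ z → z * sgn q (t ℕ.+ h) * inv (P q (n ∸ h)) * inv (P q h)
                         * prodFT (suc t) h (λ l → 1ℚ - mqz q (ℤ.- (+ l))) * P q m * P q t * inv (P q (t ∸ t)) * inv (P q (suc b))
                       * (y m * (sgn q b * y E * P q b * inv (poch L (suc b))))
                     ≡ (z * y m * y E) * (sgn q (t ℕ.+ h) * sgn q b) * inv (1ℚ - y (suc b))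
      unfolded z
        rewrite ℕₚ.m+n∸m≡n h L | prodFT≡poch t b | P-+ t (suc b) | P-m | ℕₚ.n∸n≡0 t | inv-P-suc b
              | inv-distrib-* (P q t) (poch t (suc b))
        = begin
          z * σ * iPL * (iPt * iQt) * Qt * (PL * QL) * Pt * 1ℚ * (iPb * iu) * (ym * (sgn q b * yE * Pb * iQL))
            ≡⟨ shape z σ iPL iPt iQt Qt PL QL Pt iPb iu ym (sgn q b) yE Pb iQL ⟩
          X * (PL * iPL) * (Pt * iPt) * (Qt * iQt) * (QL * iQL) * (Pb * iPb)
            ≡⟨ *-inv-cancelʳ (P≢0 b) _ ⟩
          X * (PL * iPL) * (Pt * iPt) * (Qt * iQt) * (QL * iQL)
            ≡⟨ *-inv-cancelʳ (poch≢0 L (suc b)) _ ⟩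
          X * (PL * iPL) * (Pt * iPt) * (Qt * iQt)
            ≡⟨ *-inv-cancelʳ (poch≢0 t (suc b)) _ ⟩
          X * (PL * iPL) * (Pt * iPt)
            ≡⟨ *-inv-cancelʳ (P≢0 t) _ ⟩
          X * (PL * iPL)
            ≡⟨ *-inv-cancelʳ (P≢0 L) X ⟩
          X ∎
        where
        σ = sgn q (t ℕ.+ h)
        ym = y m
        yE = y E
        iu = inv (1ℚ - y (suc b))
        PL = P q L
        iPL = inv PL
        Pt = P q t
        iPt = inv Pt
        Pb = P q b
        iPb = inv Pb
        Qt = poch t (suc b)
        iQt = inv Qt
        QL = poch L (suc b)
        iQL = inv QL
        X = (z * ym * yE) * (σ * sgn q b) * iu
        shape : ∀ z σ iPL iPt iQt Qt PL QL Pt iPb iu ym sb yE Pb iQL →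
          z * σ * iPL * (iPt * iQt) * Qt * (PL * QL) * Pt * 1ℚ * (iPb * iu) * (ym * (sb * yE * Pb * iQL))
          ≡ (z * ym * yE) * (σ * sb) * iu * (PL * iPL) * (Pt * iPt) * (Qt * iQt) * (QL * iQL) * (Pb * iPb)
        shape = solve-∀ ℚ-ring

    innerSum+tail≡0 : ∀ t b L → innerSum (t ℕ.+ suc b ℕ.+ L) (t ℕ.+ suc b) t t + tailTerm (t ℕ.+ suc b) t ≡ 0ℚ
    innerSum+tail≡0 t b L = begin
      innerSum n h t t + tailTerm h t   ≡⟨ cong₂ _+_ diagonal (tailTerm≡ t b) ⟩
      - (y E₂ * iu) + y E₂ * iu         ≡⟨ ℚₚ.+-inverseˡ (y E₂ * iu) ⟩
      0ℚ                                ∎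
      where
      h = t ℕ.+ suc b
      n = h ℕ.+ L
      m = suc (b ℕ.+ L)
      E = b ℕ.* L ℕ.+ tri (suc b)
      E₂ = tailExponent t b
      iu = inv (1ℚ - y (suc b))
      n∸t : n ∸ t ≡ m
      n∸t = trans (cong (_∸ t) (ℕₚ.+-assoc t (suc b) L)) (ℕₚ.m+n∸m≡n t (suc b ℕ.+ L))
      exponent : mqz q (Mexp q n h m t t) * y m * y E ≡ y E₂
      exponent = begin
        mqz q (Mexp q n h m t t) * y m * y E      ≡⟨ cong (_* y E) (mqz-minus (Mexp q n h m t t) m) ⟨
        mqz q (Mexp q n h m t t ℤ.- + m) * y E    ≡⟨ mqz-minus (Mexp q n h m t t ℤ.- + m) E ⟨
        mqz q (Mexp q n h m t t ℤ.- + m ℤ.- + E)  ≡⟨ cong (mqz q) (Mexp-diag t b L) ⟩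
        mqz q (ℤ.- + E₂)                          ≡⟨ mqz-neg E₂ ⟩
        y E₂                                      ∎
      diagonal : innerSum n h t t ≡ - (y E₂ * iu)
      diagonal = begin
        innerSum n h t t
          ≡⟨ innerSum-diag n h t (ℕₚ.m≤m+n t (suc b)) (ℕₚ.m≤m+n h L) ⟩
        (M₀ n h t (n ∸ t) t * inv (P q (h ∸ t))) * gaussSum (h ∸ t) (λ d → harm ((n ∸ t) ∸ d))
          ≡⟨ cong₂ (λ c H → (M₀ n h t c t * inv (P q H)) * gaussSum H (λ d → harm (c ∸ d))) n∸t (ℕₚ.m+n∸m≡n t (suc b)) ⟩
        (M₀ n h t m t * inv (P q (suc b))) * gaussSum (suc b) (λ d → harm (m ∸ d))
          ≡⟨ cong ((M₀ n h t m t * inv (P q (suc b))) *_) (gaussSum-harm b (b ℕ.+ L) (ℕₚ.m≤m+n b L)) ⟩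
        (M₀ n h t m t * inv (P q (suc b)))
          * (y m * (sgn q b * y (b ℕ.* ((b ℕ.+ L) ∸ b) ℕ.+ tri (suc b)) * P q b * inv (poch ((b ℕ.+ L) ∸ b) (suc b))))
          ≡⟨ cong (λ k → (M₀ n h t m t * inv (P q (suc b)))
                         * (y m * (sgn q b * y (b ℕ.* k ℕ.+ tri (suc b)) * P q b * inv (poch k (suc b)))))
                  (ℕₚ.m+n∸m≡n b L) ⟩
        (M₀ n h t m t * inv (P q (suc b))) * (y m * (sgn q b * y E * P q b * inv (poch L (suc b))))
          ≡⟨ M₀-diag t b L ⟩
        (mqz q (Mexp q n h m t t) * y m * y E) * (sgn q (t ℕ.+ h) * sgn q b) * iu
          ≡⟨ cong₂ (λ u v → u * v * iu) exponent (sgn-diag t b) ⟩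
        y E₂ * - 1ℚ * iu
          ≡⟨ negate (y E₂) iu ⟩
        - (y E₂ * iu) ∎
        where
        negate : ∀ a b → a * - 1ℚ * b ≡ - (a * b)
        negate = solve-∀ ℚ-ring

    D0≡0 : ∀ n h t → t ℕ.< h → h ℕ.≤ n → D0 q n h t ≡ 0ℚ
    D0≡0 n h t t<h h≤n = begin
      sumFT 0 (h ⊓ t) (innerSum n h t) + tail
        ≡⟨ cong (λ k → sumFT 0 k (innerSum n h t) + tail) (ℕₚ.m≥n⇒m⊓n≡n (ℕₚ.<⇒≤ t<h)) ⟩
      sumFT 0 t (innerSum n h t) + tail
        ≡⟨ cong (_+ tail) (trans (sumFT-+ 0 t (innerSum n h t)) (∑-sucʳ t (innerSum n h t))) ⟩
      ∑ t (innerSum n h t) + innerSum n h t t + tail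
        ≡⟨ cong (λ z → z + innerSum n h t t + tail) (∑-zero t (λ s s<t → innerSum-off n h t s s<t t<h h≤n)) ⟩
      0ℚ + innerSum n h t t + tail
        ≡⟨ cong (_+ tail) (ℚₚ.+-identityˡ (innerSum n h t t)) ⟩
      innerSum n h t t + tail
        ≡⟨ subst₂ (λ n' h' → innerSum n' h' t t + tailTerm h' t ≡ 0ℚ) n≡ h≡ (innerSum+tail≡0 t b L) ⟩
      0ℚ ∎
      where
      tail = tailTerm h t
      b = h ∸ suc t
      L = n ∸ h
      h≡ : t ℕ.+ suc b ≡ h
      h≡ = trans (ℕₚ.+-suc t b) (ℕₚ.m+[n∸m]≡n t<h)
      n≡ : t ℕ.+ suc b ℕ.+ L ≡ n
      n≡ = trans (cong (ℕ._+ L) h≡) (ℕₚ.m+[n∸m]≡n h≤n)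

open import Data.Nat using (_≤_; _<_; _%_; _+_; _^_)
open import Data.Nat.Primality using (Prime; prime⇒nonTrivial)
open import Data.Product using (∃₂; _×_; _,_)

prime-power≥2 : ∀ {p k} → Prime p → 1 ≤ k → 2 ≤ p ^ k
prime-power≥2 {p} {k} p-prime 1≤k = ℕₚ.≤-trans (ℕ.nonTrivial⇒n>1 p) p≤p^k
  where
  instance _ = prime⇒nonTrivial p-prime
  p≤p^k : p ≤ p ^ k
  p≤p^k = subst (_≤ p ^ k) (ℕₚ.*-identityʳ p) (ℕₚ.^-monoʳ-≤ p {{ℕ.nonTrivial⇒nonZero p}} 1≤k)

proposition9p6 : (q : ℕ) → (∃₂ λ p k → Prime p × p % 2 ≡ 1 × 1 ≤ k × q ≡ p ^ k) →
    (n h t : ℕ) → t < h → h ≤ n → t % 2 ≡ (h + 1) % 2 →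
    D0 q n h t ≡ 0ℚ
proposition9p6 q (p , k , p-prime , _ , 1≤k , refl) n h t t<h h≤n _ = D0≡0 q (prime-power≥2 p-prime 1≤k) n h t t<h h≤n
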